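{- Let $P$ be a closed term. Assume that $P\to\langle q_iP_i\rangle_{i\in I}$ and that for each $i\in I$ there is a derivation $\Pi_i$ of $\vdash^{w_i}P_i:\mathtt{a}_i$ (empty context, $\mathtt{a}_i$ a type distribution). Then there exists a single derivation $\Pi$ of $\vdash^{w}P:\mathtt{a}$ such that $\mathtt{a}=\bigsqcup_{i\in I}q_i\mathtt{a}_i$ and $w\ge 1+\sum_{i\in I}q_iw_i$.
   Context: Terms: values $V ::= x \mid \lambda x.M$; terms $M ::= V \mid VV \mid M\oplus M \mid \mathtt{let}\ x = M\ \mathtt{in}\ M$; $M\{V/x\}$ is capture-avoiding substitution. A multidistribution on terms is a finite multiset $\langle p_iM_i\rangle_{i\in I}$ with $p_i\in(0,1]$, $\sum_ip_i\le1$. One-step reduction: $(\lambda x.M)V\to\langle 1\,M\{V/x\}\rangle$; $\mathtt{let}\ x=V\ \mathtt{in}\ M\to\langle 1\,M\{V/x\}\rangle$; $M\oplus N\to\langle\tfrac12 M,\tfrac12 N\rangle$; if $N\to\langle p_iN_i\rangle_{i\in I}$ then $\mathtt{let}\ x=N\ \mathtt{in}\ M\to\langle p_i(\mathtt{let}\ x=N_i\ \mathtt{in}\ M)\rangle_{i\in I}$. Types: arrow types $\mathtt{A} ::= \mathcal{M}\to \mathtt{a}$; intersection types $\mathcal{M} ::= [q_1\cdot \mathtt{A}_1,\dots,q_n\cdot\mathtt{A}_n]$ ($n\ge0$, scale factors $q_i\in(0,1]\cap\mathbb{Q}$); type distributions $\mathtt{a} ::= \langle p_1\mathcal{M}_1,\dots,p_n\mathcal{M}_n\rangle$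 ($n\ge0$, $p_i\in(0,1]$, $\sum p_i\le1$); $\mathbf{0}$ is the empty type distribution. Scaling: $u\cdot[q_i\cdot\mathtt{A}_i]_i=[(uq_i)\cdot \mathtt{A}_i]_i$, $u\cdot\langle p_i\mathcal{M}_i\rangle_i=\langle (up_i)\mathcal{M}_i\rangle_i$; $\uplus,\sqcup$ multiset unions. Typing contexts map variables to intersection types (finitely many nonempty), pointwise $\uplus$ and scaling. Rules for $\Gamma\vdash^{w}M:\tau$ ($w\in\mathbb{Q}$): (Var) $x:\mathcal{M}\vdash^0 x:\mathcal{M}$. (Zero) $\vdash^0 M:\mathbf{0}$. (@) from $\Gamma\vdash^{w}V:[1\cdot(\mathcal{M}\to\mathtt{b})]$, $\Delta\vdash^{v}W:\mathcal{M}$ infer $\Gamma\uplus\Delta\vdash^{w+v}VW:\mathtt{b}$. ($\oplus$) from $\Gamma\vdash^{w}M:\mathtt{a}$, $\Delta\vdash^{v}N:\mathtt{b}$ infer $\tfrac12\cdot\Gamma\uplus\tfrac12\cdot\Delta\vdash^{\frac12 w+\frac12 v+1}M\oplus N:\tfrac12\mathtt{a}\sqcup\tfrac12\mathtt{b}$. ($\lambda$) from $\Gamma,x:\mathcal{M}\vdash^{w}M:\mathtt{b}$ infer $\Gamma\vdash^{w+1}\lambda x.M:\mathcal{M}\to\mathtt{b}$. (let) from $\Gamma\vdash^{v}N:\langle p_k\mathcal{M}_k\rangle_{k\in K}$ and $\Delta_k,x:\mathcal{M}_k\vdash^{w_k}M:\mathtt{b}_k$ ($k\in K$) infer $\Gamma\uplus_{k}p_k\cdot\Delta_k\vdash^{\sum_k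 p_kw_k+v+1}\mathtt{let}\ x=N\ \mathtt{in}\ M:\bigsqcup_k p_k\mathtt{b}_k$. (Val) from $\Gamma\vdash^{w}V:\mathcal{M}$ infer $\Gamma\vdash^{w}V:\langle 1\mathcal{M}\rangle$. (!) for finite possibly empty $I$, from $\Gamma_i\vdash^{w_i}V:\mathtt{A}_i$ and scale factors $q_i$ infer $\uplus_i q_i\cdot\Gamma_i\vdash^{\sum_i q_iw_i}V:[q_i\cdot\mathtt{A}_i]_{i\in I}$. -}

module Defs where

open import Data.Nat using (ℕ; zero; suc)
open import Data.Fin using (Fin; zero; suc)
open import Data.Product using (_×_; _,_; proj₁; proj₂)
open import Data.List using (List; []; _∷_; _++_; map)
open import Data.Vec using (Vec; replicate; zipWith; _[_]≔_)
  renaming ([] to []ᵥ; _∷_ to _∷ᵥ_; map to mapᵥ)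
open import Data.Vec.Relation.Binary.Pointwise.Inductive using (Pointwise)
open import Data.Rational using (ℚ; 0ℚ; 1ℚ; ½; _+_; _*_; _≤_; _<_)
open import Relation.Binary.PropositionalEquality using (_≡_)

-- Terms (well-scoped de Bruijn syntax; Term 0 = closed terms)

mutual
  data Val (n : ℕ) : Set where
    var : Fin n → Val n
    lam : Term (suc n) → Val n

  data Term (n : ℕ) : Set where
    val  : Val n → Term n
    app  : Val n → Val n → Term n
    _⊕_  : Term n → Term n → Term n
    lett : Term n → Term (suc n) → Term n   -- let x = N in M  (lett N M)

extR : ∀ {n m} → (Fin n → Fin m) → Fin (suc n) → Fin (suc m)
extR ρ zero    = zero
extR ρ (suc i) = suc (ρ i)

mutual
  renV : ∀ {n m} → (Fin n → Fin m) → Val n → Val m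
  renV ρ (var i) = var (ρ i)
  renV ρ (lam M) = lam (renT (extR ρ) M)

  renT : ∀ {n m} → (Fin n → Fin m) → Term n → Term m
  renT ρ (val V)    = val (renV ρ V)
  renT ρ (app V W)  = app (renV ρ V) (renV ρ W)
  renT ρ (M ⊕ N)    = renT ρ M ⊕ renT ρ N
  renT ρ (lett N M) = lett (renT ρ N) (renT (extR ρ) M)

extS : ∀ {n m} → (Fin n → Val m) → Fin (suc n) → Val (suc m)
extS σ zero    = var zero
extS σ (suc i) = renV suc (σ i)

mutual
  subV : ∀ {n m} → (Fin n → Val m) → Val n → Val m
  subV σ (var i) = σ i
  subV σ (lam M) = lam (subT (extS σ) M)

  subT : ∀ {n m} → (Fin n → Val m) → Term n → Term m
  subT σ (val V)    = val (subV σ V)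
  subT σ (app V W)  = app (subV σ V) (subV σ W)
  subT σ (M ⊕ N)    = subT σ M ⊕ subT σ N
  subT σ (lett N M) = lett (subT σ N) (subT (extS σ) M)

σ₀ : ∀ {n} → Val n → Fin (suc n) → Val n
σ₀ V zero    = V
σ₀ V (suc i) = var i

-- M {V/x}, x being the outermost bound variable (index 0)
_[_/0] : ∀ {n} → Term (suc n) → Val n → Term n
M [ V /0] = subT (σ₀ V) M

-- Multidistributions (finite multisets, represented by lists) and reduction

MDist : ℕ → Set
MDist n = List (ℚ × Term n)

data _⟶_ {n : ℕ} : Term n → MDist n → Set where
  β      : ∀ (M : Term (suc n)) (V : Val n) →
           app (lam M) V ⟶ ((1ℚ , M [ V /0]) ∷ [])
  letV   : ∀ (V : Val n) (M : Term (suc n)) →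
           lett (val V) M ⟶ ((1ℚ , M [ V /0]) ∷ [])
  choice : ∀ (M N : Term n) →
           (M ⊕ N) ⟶ ((½ , M) ∷ (½ , N) ∷ [])
  letC   : ∀ {N : Term n} {D : MDist n} (M : Term (suc n)) →
           N ⟶ D → lett N M ⟶ map (λ pN → (proj₁ pN , lett (proj₂ pN) M)) D

-- Types (multisets represented by lists)

-- arrow type  𝓜 → a, with 𝓜 an intersection type, a a type distribution
data Arrow : Set where
  _⇒_ : List (ℚ × Arrow) → List (ℚ × List (ℚ × Arrow)) → Arrow

Inter : Set
Inter = List (ℚ × Arrow)

TDist : Set
TDist = List (ℚ × Inter)

𝟎 : TDist
𝟎 = []

sumD : TDist → ℚ
sumD []             = 0ℚ
sumD ((p , _) ∷ a)  = p + sumD a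

mutual
  data WFA : Arrow → Set where
    wf⇒ : ∀ {M a} → WFI M → WFD a → WFA (M ⇒ a)

  data WFI : Inter → Set where
    []  : WFI []
    _∷_ : ∀ {q A M} → (0ℚ < q × q ≤ 1ℚ × WFA A) → WFI M → WFI ((q , A) ∷ M)

  data WFDs : TDist → Set where
    []  : WFDs []
    _∷_ : ∀ {p M a} → (0ℚ < p × p ≤ 1ℚ × WFI M) → WFDs a → WFDs ((p , M) ∷ a)

  data WFD : TDist → Set where
    wfD : ∀ {a} → WFDs a → sumD a ≤ 1ℚ → WFD a

-- multiset equality, up to multiset equality of the nested types
mutual
  data _≈A_ : Arrow → Arrow → Set where
    ⇒-cong : ∀ {M M' a a'} → M ≈I M' → a ≈D a' → (M ⇒ a) ≈A (M' ⇒ a')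

  data _≈I_ : Inter → Inter → Set where
    []    : [] ≈I []
    prep  : ∀ {q A A' M M'} → A ≈A A' → M ≈I M' → ((q , A) ∷ M) ≈I ((q , A') ∷ M')
    swap  : ∀ {x y M} → (x ∷ y ∷ M) ≈I (y ∷ x ∷ M)
    trans : ∀ {M M' M''} → M ≈I M' → M' ≈I M'' → M ≈I M''

  data _≈D_ : TDist → TDist → Set where
    []    : [] ≈D []
    prep  : ∀ {p M M' a a'} → M ≈I M' → a ≈D a' → ((p , M) ∷ a) ≈D ((p , M') ∷ a')
    swap  : ∀ {x y a} → (x ∷ y ∷ a) ≈D (y ∷ x ∷ a)
    trans : ∀ {a a' a''} → a ≈D a' → a' ≈D a'' → a ≈D a''

scaleI : ℚ → Inter → Inter
scaleI u = map (λ qA → (u * proj₁ qA , proj₂ qA))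

scaleD : ℚ → TDist → TDist
scaleD u = map (λ pM → (u * proj₁ pM , proj₂ pM))

Σℚ : (k : ℕ) → (Fin k → ℚ) → ℚ
Σℚ zero    f = 0ℚ
Σℚ (suc k) f = f zero + Σℚ k (λ i → f (suc i))

⨆ : (k : ℕ) → (Fin k → TDist) → TDist
⨆ zero    f = []
⨆ (suc k) f = f zero ++ ⨆ k (λ i → f (suc i))

⨄I : (k : ℕ) → (Fin k → Inter) → Inter
⨄I zero    f = []
⨄I (suc k) f = f zero ++ ⨄I k (λ i → f (suc i))

lookupL : ∀ {A : Set} (xs : List A) → Fin (Data.List.length xs) → A
lookupL (x ∷ xs) zero    = x
lookupL (x ∷ xs) (suc i) = lookupL xs i

Ctx : ℕ → Set
Ctx n = Vec Inter n

ε : ∀ {n} → Ctx n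
ε {n} = replicate n []

_∶ᶜ_ : ∀ {n} → Fin n → Inter → Ctx n
x ∶ᶜ M = ε [ x ]≔ M

_⊎_ : ∀ {n} → Ctx n → Ctx n → Ctx n
_⊎_ = zipWith _++_

_·ᶜ_ : ∀ {n} → ℚ → Ctx n → Ctx n
u ·ᶜ Γ = mapᵥ (scaleI u) Γ

⨄ : ∀ {n} (k : ℕ) → (Fin k → Ctx n) → Ctx n
⨄ zero    f = ε
⨄ (suc k) f = f zero ⊎ ⨄ k (λ i → f (suc i))

_≈C_ : ∀ {n} → Ctx n → Ctx n → Set
_≈C_ = Pointwise _≈I_

infix 3 _⊢ᴬ[_]_∶_ _⊢ᴵ[_]_∶_ _⊢[_]_∶_

mutual
  data _⊢ᴬ[_]_∶_ {n : ℕ} : Ctx n → ℚ → Val n → Arrow → Set where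
    λ-rule : ∀ {Γ M w b} {body : Term (suc n)} →
             (M ∷ᵥ Γ) ⊢[ w ] body ∶ b →
             Γ ⊢ᴬ[ w + 1ℚ ] lam body ∶ (M ⇒ b)
    exA    : ∀ {Γ Γ' w V A A'} → Γ ⊢ᴬ[ w ] V ∶ A → Γ ≈C Γ' → A ≈A A' →
             Γ' ⊢ᴬ[ w ] V ∶ A'

  data _⊢ᴵ[_]_∶_ {n : ℕ} : Ctx n → ℚ → Val n → Inter → Set where
    var-rule : ∀ (x : Fin n) (M : Inter) → WFI M →
               (x ∶ᶜ M) ⊢ᴵ[ 0ℚ ] var x ∶ M
    !-rule   : ∀ {V} (k : ℕ) (q : Fin k → ℚ) (Γ : Fin k → Ctx n)
               (w : Fin k → ℚ) (A : Fin k → Arrow) →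
               (∀ i → 0ℚ < q i × q i ≤ 1ℚ) →
               (∀ i → Γ i ⊢ᴬ[ w i ] V ∶ A i) →
               ⨄ k (λ i → q i ·ᶜ Γ i) ⊢ᴵ[ Σℚ k (λ i → q i * w i) ] V
                 ∶ ⨄I k (λ i → (q i , A i) ∷ [])
    exI      : ∀ {Γ Γ' w V M M'} → Γ ⊢ᴵ[ w ] V ∶ M → Γ ≈C Γ' → M ≈I M' →
               Γ' ⊢ᴵ[ w ] V ∶ M'

  data _⊢[_]_∶_ {n : ℕ} : Ctx n → ℚ → Term n → TDist → Set where
    zero-rule : ∀ (M : Term n) → ε ⊢[ 0ℚ ] M ∶ 𝟎
    app-rule    : ∀ {Γ Δ w v V W M b} →
                Γ ⊢ᴵ[ w ] V ∶ ((1ℚ , (M ⇒ b)) ∷ []) →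
                Δ ⊢ᴵ[ v ] W ∶ M →
                (Γ ⊎ Δ) ⊢[ w + v ] app V W ∶ b
    ⊕-rule    : ∀ {Γ Δ w v M N a b} →
                Γ ⊢[ w ] M ∶ a → Δ ⊢[ v ] N ∶ b →
                ((½ ·ᶜ Γ) ⊎ (½ ·ᶜ Δ)) ⊢[ ½ * w + ½ * v + 1ℚ ] (M ⊕ N)
                  ∶ (scaleD ½ a ++ scaleD ½ b)
    let-rule  : ∀ {Γ v N a} {M : Term (suc n)} →
                Γ ⊢[ v ] N ∶ a →
                (Δ : Fin (Data.List.length a) → Ctx n)
                (w : Fin (Data.List.length a) → ℚ)
                (b : Fin (Data.List.length a) → TDist) →
                (∀ k → (proj₂ (lookupL a k) ∷ᵥ Δ k) ⊢[ w k ] M ∶ b k) →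
                (Γ ⊎ ⨄ (Data.List.length a) (λ k → proj₁ (lookupL a k) ·ᶜ Δ k))
                  ⊢[ Σℚ (Data.List.length a) (λ k → proj₁ (lookupL a k) * w k) + v + 1ℚ ]
                  lett N M
                  ∶ ⨆ (Data.List.length a) (λ k → scaleD (proj₁ (lookupL a k)) (b k))
    val-rule  : ∀ {Γ w V M} → Γ ⊢ᴵ[ w ] V ∶ M → Γ ⊢[ w ] val V ∶ ((1ℚ , M) ∷ [])
    exT       : ∀ {Γ Γ' w M a a'} → Γ ⊢[ w ] M ∶ a → Γ ≈C Γ' → a ≈D a' →
                Γ' ⊢[ w ] M ∶ a'

-- A choice step is undone by one (⊕) rule.  A step inside a
-- let is undone by splitting the typing of each let Nᵢ M of the reduct into a typing of Nᵢ and
-- typings of the body M, and recombining by induction; each of these lets pays 1 for its (let)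
-- rule, and weighted by the probabilities these payments add up to the mass 1 of the reduct.
-- The redexes (λx.M)V and let x = V in M come down to the substitution lemma read backwards:
-- a typing of M{V/x} splits into a typing of M with x : 𝓜 and a typing V : 𝓜 whose weights add up.
-- The pieces of V consumed by the various occurrences of x (in both branches of ⊕, in the scaled
-- premises of (let) and (!)) can be gathered into one typing because typings of a value are
-- closed under ⊎ and under scaling by probabilities: a variable is typed by (Var) at any 𝓜, and
-- an abstraction by (!) from an arbitrary list of scaled arrow typings.

module Submission where

open import Defs
open import Data.Nat using (ℕ; zero; suc)
open import Data.Fin using (Fin; zero; suc)
open import Data.Product using (Σ; _×_; _,_; proj₁; proj₂)
open import Data.List using (List; length; []; _∷_; _++_; map)
import Data.List.Properties as List
open import Data.List.Relation.Unary.All using (All; []; _∷_)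
open import Data.List.Relation.Binary.Permutation.Propositional as ↭ using (_↭_)
import Data.List.Relation.Binary.Permutation.Propositional.Properties as ↭
open import Data.Vec using ([]; _∷_; lookup)
import Data.Vec.Properties as Vec
open import Data.Vec.Relation.Unary.All using ([]; _∷_) renaming (All to AllV)
import Data.Vec.Relation.Binary.Pointwise.Inductive as Pointwise
open Pointwise using ([]; _∷_)
open import Data.Rational using (ℚ; 1ℚ; 0ℚ; ½; _+_; _*_; _≤_; _<_; NonNegative)
import Data.Rational as ℚ using (positive; nonNegative)
import Data.Rational.Properties as ℚ
open import Data.Rational.Solver using (module +-*-Solver)
open +-*-Solver using (solve; _:=_; _:+_; _:*_; con)
open import Data.Empty using (⊥-elim)
open import Function using (_∘_)
open import Relation.Nullary using (¬_)
open import Relation.Binary.PropositionalEquality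
  using (_≡_; refl; sym; cong; cong₂; subst) renaming (trans to ≡-trans)

mutual
  ≈A-refl : ∀ A → A ≈A A
  ≈A-refl (M ⇒ a) = ⇒-cong (≈I-refl M) (≈D-refl a)

  ≈I-refl : ∀ M → M ≈I M
  ≈I-refl []            = []
  ≈I-refl ((q , A) ∷ M) = prep (≈A-refl A) (≈I-refl M)

  ≈D-refl : ∀ a → a ≈D a
  ≈D-refl []            = []
  ≈D-refl ((p , M) ∷ a) = prep (≈I-refl M) (≈D-refl a)

mutual
  ≈A-sym : ∀ {A B} → A ≈A B → B ≈A A
  ≈A-sym (⇒-cong M≈ a≈) = ⇒-cong (≈I-sym M≈) (≈D-sym a≈)

  ≈I-sym : ∀ {M N} → M ≈I N → N ≈I M
  ≈I-sym []            = []
  ≈I-sym (prep A≈ M≈)  = prep (≈A-sym A≈) (≈I-sym M≈)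
  ≈I-sym swap          = swap
  ≈I-sym (trans M≈ N≈) = trans (≈I-sym N≈) (≈I-sym M≈)

  ≈D-sym : ∀ {a b} → a ≈D b → b ≈D a
  ≈D-sym []            = []
  ≈D-sym (prep M≈ a≈)  = prep (≈I-sym M≈) (≈D-sym a≈)
  ≈D-sym swap          = swap
  ≈D-sym (trans a≈ b≈) = trans (≈D-sym b≈) (≈D-sym a≈)

≡⇒≈I : ∀ {M N} → M ≡ N → M ≈I N
≡⇒≈I {M} refl = ≈I-refl M

≡⇒≈D : ∀ {a b} → a ≡ b → a ≈D b
≡⇒≈D {a} refl = ≈D-refl a

↭⇒≈I : ∀ {M N} → M ↭ N → M ≈I N
↭⇒≈I ↭.refl                     = ≈I-refl _
↭⇒≈I (↭.prep (q , A) M↭)        = prep (≈A-refl A) (↭⇒≈I M↭)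
↭⇒≈I (↭.swap (q , A) (r , B) M↭) = trans swap (prep (≈A-refl B) (prep (≈A-refl A) (↭⇒≈I M↭)))
↭⇒≈I (↭.trans M↭ N↭)            = trans (↭⇒≈I M↭) (↭⇒≈I N↭)

++-cong-≈I : ∀ {M M' N N'} → M ≈I M' → N ≈I N' → (M ++ N) ≈I (M' ++ N')
++-cong-≈I {M' = M'} {N} M≈ N≈ = trans (left N M≈) (right M' N≈)
  where
  left : ∀ {M M'} N → M ≈I M' → (M ++ N) ≈I (M' ++ N)
  left N []            = ≈I-refl N
  left N (prep A≈ M≈)  = prep A≈ (left N M≈)
  left N swap          = swap
  left N (trans M≈ N≈) = trans (left N M≈) (left N N≈)

  right : ∀ M {N N'} → N ≈I N' → (M ++ N) ≈I (M ++ N')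
  right []            N≈ = N≈
  right ((q , A) ∷ M) N≈ = prep (≈A-refl A) (right M N≈)

++-cong-≈D : ∀ {a a' b b'} → a ≈D a' → b ≈D b' → (a ++ b) ≈D (a' ++ b')
++-cong-≈D {a' = a'} {b} a≈ b≈ = trans (left b a≈) (right a' b≈)
  where
  left : ∀ {a a'} b → a ≈D a' → (a ++ b) ≈D (a' ++ b)
  left b []            = ≈D-refl b
  left b (prep M≈ a≈)  = prep M≈ (left b a≈)
  left b swap          = swap
  left b (trans a≈ c≈) = trans (left b a≈) (left b c≈)

  right : ∀ a {b b'} → b ≈D b' → (a ++ b) ≈D (a ++ b')
  right []            b≈ = b≈
  right ((p , M) ∷ a) b≈ = prep (≈I-refl M) (right a b≈)

scaleI-cong : ∀ u {M M'} → M ≈I M' → scaleI u M ≈I scaleI u M'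
scaleI-cong u []            = []
scaleI-cong u (prep A≈ M≈)  = prep A≈ (scaleI-cong u M≈)
scaleI-cong u swap          = swap
scaleI-cong u (trans M≈ N≈) = trans (scaleI-cong u M≈) (scaleI-cong u N≈)

scaleD-cong : ∀ u {a a'} → a ≈D a' → scaleD u a ≈D scaleD u a'
scaleD-cong u []            = []
scaleD-cong u (prep M≈ a≈)  = prep M≈ (scaleD-cong u a≈)
scaleD-cong u swap          = swap
scaleD-cong u (trans a≈ b≈) = trans (scaleD-cong u a≈) (scaleD-cong u b≈)

scaleI-* : ∀ u v M → scaleI u (scaleI v M) ≡ scaleI (u * v) M
scaleI-* u v []            = refl
scaleI-* u v ((q , A) ∷ M) = cong₂ _∷_ (cong (_, A) (sym (ℚ.*-assoc u v q))) (scaleI-* u v M)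

scaleD-* : ∀ u v a → scaleD u (scaleD v a) ≡ scaleD (u * v) a
scaleD-* u v []            = refl
scaleD-* u v ((p , M) ∷ a) = cong₂ _∷_ (cong (_, M) (sym (ℚ.*-assoc u v p))) (scaleD-* u v a)

scaleD-identity : ∀ a → scaleD 1ℚ a ≡ a
scaleD-identity []            = refl
scaleD-identity ((p , M) ∷ a) = cong₂ _∷_ (cong (_, M) (ℚ.*-identityˡ p)) (scaleD-identity a)

≈C-refl : ∀ {n} (Γ : Ctx n) → Γ ≈C Γ
≈C-refl Γ = Pointwise.refl (≈I-refl _)

≈C-sym : ∀ {n} {Γ Δ : Ctx n} → Γ ≈C Δ → Δ ≈C Γ
≈C-sym = Pointwise.sym ≈I-sym

≈C-trans : ∀ {n} {Γ Δ Θ : Ctx n} → Γ ≈C Δ → Δ ≈C Θ → Γ ≈C Θ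
≈C-trans = Pointwise.trans trans

≡⇒≈C : ∀ {n} {Γ Δ : Ctx n} → Γ ≡ Δ → Γ ≈C Δ
≡⇒≈C {Γ = Γ} refl = ≈C-refl Γ

⊎-cong : ∀ {n} {Γ Γ' Δ Δ' : Ctx n} → Γ ≈C Γ' → Δ ≈C Δ' → (Γ ⊎ Δ) ≈C (Γ' ⊎ Δ')
⊎-cong []        []        = []
⊎-cong (M≈ ∷ Γ≈) (N≈ ∷ Δ≈) = ++-cong-≈I M≈ N≈ ∷ ⊎-cong Γ≈ Δ≈

·ᶜ-cong : ∀ {n} u {Γ Γ' : Ctx n} → Γ ≈C Γ' → (u ·ᶜ Γ) ≈C (u ·ᶜ Γ')
·ᶜ-cong u []        = []
·ᶜ-cong u (M≈ ∷ Γ≈) = scaleI-cong u M≈ ∷ ·ᶜ-cong u Γ≈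

⊎-assoc : ∀ {n} (Γ Δ Θ : Ctx n) → ((Γ ⊎ Δ) ⊎ Θ) ≡ (Γ ⊎ (Δ ⊎ Θ))
⊎-assoc []      []      []      = refl
⊎-assoc (M ∷ Γ) (N ∷ Δ) (O ∷ Θ) = cong₂ _∷_ (List.++-assoc M N O) (⊎-assoc Γ Δ Θ)

⊎-identityˡ : ∀ {n} (Γ : Ctx n) → (ε ⊎ Γ) ≡ Γ
⊎-identityˡ []      = refl
⊎-identityˡ (M ∷ Γ) = cong (M ∷_) (⊎-identityˡ Γ)

⊎-identityʳ : ∀ {n} (Γ : Ctx n) → (Γ ⊎ ε) ≡ Γ
⊎-identityʳ []      = refl
⊎-identityʳ (M ∷ Γ) = cong₂ _∷_ (List.++-identityʳ M) (⊎-identityʳ Γ)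

⊎-interchange : ∀ {n} (Γ₁ Γ₂ Δ₁ Δ₂ : Ctx n) → ((Γ₁ ⊎ Γ₂) ⊎ (Δ₁ ⊎ Δ₂)) ≈C ((Γ₁ ⊎ Δ₁) ⊎ (Γ₂ ⊎ Δ₂))
⊎-interchange []       []       []       []       = []
⊎-interchange (a ∷ Γ₁) (b ∷ Γ₂) (c ∷ Δ₁) (d ∷ Δ₂) = ↭⇒≈I a++b++c++d↭ ∷ ⊎-interchange Γ₁ Γ₂ Δ₁ Δ₂
  where
  a++b++c++d↭ : ((a ++ b) ++ (c ++ d)) ↭ ((a ++ c) ++ (b ++ d))
  a++b++c++d↭ = ↭.↭-trans (↭.++-assoc a b (c ++ d))
                  (↭.↭-trans (↭.++⁺ˡ a (↭.shifts b c)) (↭.↭-sym (↭.++-assoc a c (b ++ d))))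

·ᶜ-distrib-⊎ : ∀ {n} u (Γ Δ : Ctx n) → (u ·ᶜ (Γ ⊎ Δ)) ≡ ((u ·ᶜ Γ) ⊎ (u ·ᶜ Δ))
·ᶜ-distrib-⊎ u []      []      = refl
·ᶜ-distrib-⊎ u (M ∷ Γ) (N ∷ Δ) = cong₂ _∷_ (List.map-++ _ M N) (·ᶜ-distrib-⊎ u Γ Δ)

·ᶜ-ε : ∀ {n} u → (u ·ᶜ ε {n}) ≡ ε
·ᶜ-ε {zero}  u = refl
·ᶜ-ε {suc n} u = cong ([] ∷_) (·ᶜ-ε u)

·ᶜ-* : ∀ {n} u v (Γ : Ctx n) → (u ·ᶜ (v ·ᶜ Γ)) ≡ ((u * v) ·ᶜ Γ)
·ᶜ-* u v []      = refl
·ᶜ-* u v (M ∷ Γ) = cong₂ _∷_ (scaleI-* u v M) (·ᶜ-* u v Γ)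

ctx₀≡ε : (Γ : Ctx 0) → Γ ≡ ε
ctx₀≡ε [] = refl

∶ᶜ-[] : ∀ {n} (x : Fin n) → (x ∶ᶜ []) ≡ ε
∶ᶜ-[] zero    = refl
∶ᶜ-[] (suc x) = cong ([] ∷_) (∶ᶜ-[] x)

∶ᶜ-⊎ : ∀ {n} (x : Fin n) M N → ((x ∶ᶜ M) ⊎ (x ∶ᶜ N)) ≡ (x ∶ᶜ (M ++ N))
∶ᶜ-⊎ zero    M N = cong ((M ++ N) ∷_) (⊎-identityˡ ε)
∶ᶜ-⊎ (suc x) M N = cong ([] ∷_) (∶ᶜ-⊎ x M N)

·ᶜ-∶ᶜ : ∀ {n} u (x : Fin n) M → (u ·ᶜ (x ∶ᶜ M)) ≡ (x ∶ᶜ scaleI u M)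
·ᶜ-∶ᶜ u zero    M = cong (scaleI u M ∷_) (·ᶜ-ε u)
·ᶜ-∶ᶜ u (suc x) M = cong ([] ∷_) (·ᶜ-∶ᶜ u x M)

∶ᶜ-cong : ∀ {n} (x : Fin n) {M N} → M ≈I N → (x ∶ᶜ M) ≈C (x ∶ᶜ N)
∶ᶜ-cong zero    M≈ = M≈ ∷ ≈C-refl ε
∶ᶜ-cong (suc x) M≈ = [] ∷ ∶ᶜ-cong x M≈

⨄-cong : ∀ {n} K {f g : Fin K → Ctx n} → (∀ k → f k ≈C g k) → ⨄ K f ≈C ⨄ K g
⨄-cong zero    f≈g = ≈C-refl ε
⨄-cong (suc K) f≈g = ⊎-cong (f≈g zero) (⨄-cong K (λ k → f≈g (suc k)))

⨄-⊎ : ∀ {n} K (f g : Fin K → Ctx n) → ⨄ K (λ k → f k ⊎ g k) ≈C (⨄ K f ⊎ ⨄ K g)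
⨄-⊎ zero    f g = ≡⇒≈C (sym (⊎-identityˡ ε))
⨄-⊎ (suc K) f g =
  ≈C-trans (⊎-cong (≈C-refl (f zero ⊎ g zero)) (⨄-⊎ K (λ k → f (suc k)) (λ k → g (suc k))))
           (⊎-interchange (f zero) (g zero) _ _)

·ᶜ-⨄ : ∀ {n} u K (f : Fin K → Ctx n) → (u ·ᶜ ⨄ K f) ≡ ⨄ K (λ k → u ·ᶜ f k)
·ᶜ-⨄ u zero    f = ·ᶜ-ε u
·ᶜ-⨄ u (suc K) f = ≡-trans (·ᶜ-distrib-⊎ u (f zero) _) (cong ((u ·ᶜ f zero) ⊎_) (·ᶜ-⨄ u K (λ k → f (suc k))))

⨄-[]∷ : ∀ {n} K (f : Fin K → Ctx n) → ⨄ K (λ k → [] ∷ f k) ≡ ([] ∷ ⨄ K f)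
⨄-[]∷ zero    f = refl
⨄-[]∷ (suc K) f = cong (([] ∷ f zero) ⊎_) (⨄-[]∷ K (λ k → f (suc k)))

Prob : ℚ → Set
Prob q = 0ℚ < q × q ≤ 1ℚ

Prob⇒NonNegative : ∀ {q} → Prob q → NonNegative q
Prob⇒NonNegative {q} (0<q , _) = ℚ.pos⇒nonNeg q {{ℚ.positive 0<q}}

Prob-* : ∀ {q r} → Prob q → Prob r → Prob (q * r)
Prob-* {q} {r} q∈@(0<q , q≤1) (0<r , r≤1) =
  ℚ.positive⁻¹ (q * r) {{ℚ.pos*pos⇒pos q {{ℚ.positive 0<q}} r {{ℚ.positive 0<r}}}} ,
  ℚ.≤-trans (ℚ.*-monoˡ-≤-nonNeg q {{Prob⇒NonNegative q∈}} r≤1)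
            (ℚ.≤-trans (ℚ.≤-reflexive (ℚ.*-identityʳ q)) q≤1)

Prob-½ : Prob ½
Prob-½ = ℚ.positive⁻¹ ½ , ℚ.≤ᵇ⇒≤ _

Prob-1 : Prob 1ℚ
Prob-1 = ℚ.positive⁻¹ 1ℚ , ℚ.≤-refl

*-≤-of-≤1 : ∀ {p s} → Prob p → s ≤ 1ℚ → p * s ≤ p
*-≤-of-≤1 {p} p∈ s≤1 =
  ℚ.≤-trans (ℚ.*-monoˡ-≤-nonNeg p {{Prob⇒NonNegative p∈}} s≤1) (ℚ.≤-reflexive (ℚ.*-identityʳ p))

Σℚ-cong : ∀ K {f g : Fin K → ℚ} → (∀ k → f k ≡ g k) → Σℚ K f ≡ Σℚ K g
Σℚ-cong zero    f≡g = refl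
Σℚ-cong (suc K) f≡g = cong₂ _+_ (f≡g zero) (Σℚ-cong K (λ k → f≡g (suc k)))

Σℚ-mono-≤ : ∀ K {f g : Fin K → ℚ} → (∀ k → f k ≤ g k) → Σℚ K f ≤ Σℚ K g
Σℚ-mono-≤ zero    f≤g = ℚ.≤-refl
Σℚ-mono-≤ (suc K) f≤g = ℚ.+-mono-≤ (f≤g zero) (Σℚ-mono-≤ K (λ k → f≤g (suc k)))

Σℚ-+ : ∀ K (f g : Fin K → ℚ) → Σℚ K (λ k → f k + g k) ≡ Σℚ K f + Σℚ K g
Σℚ-+ zero    f g = refl
Σℚ-+ (suc K) f g =
  ≡-trans (cong ((f zero + g zero) +_) (Σℚ-+ K (λ k → f (suc k)) (λ k → g (suc k))))
          (solve 4 (λ a b c d → (a :+ b) :+ (c :+ d) := (a :+ c) :+ (b :+ d)) refl (f zero) (g zero) _ _)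

Σℚ-*ˡ : ∀ u K (f : Fin K → ℚ) → u * Σℚ K f ≡ Σℚ K (λ k → u * f k)
Σℚ-*ˡ u zero    f = ℚ.*-zeroʳ u
Σℚ-*ˡ u (suc K) f =
  ≡-trans (ℚ.*-distribˡ-+ u (f zero) _) (cong ((u * f zero) +_) (Σℚ-*ˡ u K (λ k → f (suc k))))

Σℚ-*-split : ∀ K (p w w₁ w₂ : Fin K → ℚ) → (∀ k → w k ≡ w₁ k + w₂ k) →
             Σℚ K (λ k → p k * w k) ≡ Σℚ K (λ k → p k * w₁ k) + Σℚ K (λ k → p k * w₂ k)
Σℚ-*-split K p w w₁ w₂ w≡ =
  ≡-trans (Σℚ-cong K (λ k → ≡-trans (cong (p k *_) (w≡ k)) (ℚ.*-distribˡ-+ (p k) (w₁ k) (w₂ k))))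
          (Σℚ-+ K (λ k → p k * w₁ k) (λ k → p k * w₂ k))

WFC : ∀ {n} → Ctx n → Set
WFC = AllV WFI

WFI-++ : ∀ {M N} → WFI M → WFI N → WFI (M ++ N)
WFI-++ []         N-wf = N-wf
WFI-++ (A ∷ M-wf) N-wf = A ∷ WFI-++ M-wf N-wf

WFI-scale : ∀ {u M} → Prob u → WFI M → WFI (scaleI u M)
WFI-scale u∈ []                       = []
WFI-scale u∈ ((0<q , q≤1 , A) ∷ M-wf) with Prob-* u∈ (0<q , q≤1)
... | 0<uq , uq≤1 = (0<uq , uq≤1 , A) ∷ WFI-scale u∈ M-wf

WFDs-++ : ∀ {a b} → WFDs a → WFDs b → WFDs (a ++ b)
WFDs-++ []         b-wf = b-wf
WFDs-++ (M ∷ a-wf) b-wf = M ∷ WFDs-++ a-wf b-wf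

WFDs-scale : ∀ {u a} → Prob u → WFDs a → WFDs (scaleD u a)
WFDs-scale u∈ []                       = []
WFDs-scale u∈ ((0<p , p≤1 , M) ∷ a-wf) with Prob-* u∈ (0<p , p≤1)
... | 0<up , up≤1 = (0<up , up≤1 , M) ∷ WFDs-scale u∈ a-wf

WFD-lookupL : ∀ {a} → WFD a → ∀ k → Prob (proj₁ (lookupL a k)) × WFI (proj₂ (lookupL a k))
WFD-lookupL (wfD a-wf _) = go a-wf
  where
  go : ∀ {a} → WFDs a → ∀ k → Prob (proj₁ (lookupL a k)) × WFI (proj₂ (lookupL a k))
  go ((0<p , p≤1 , M) ∷ _) zero    = (0<p , p≤1) , M
  go (_ ∷ a-wf)            (suc k) = go a-wf k

sumD-++ : ∀ a b → sumD (a ++ b) ≡ sumD a + sumD b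
sumD-++ []            b = sym (ℚ.+-identityˡ _)
sumD-++ ((p , M) ∷ a) b = ≡-trans (cong (p +_) (sumD-++ a b)) (sym (ℚ.+-assoc p _ _))

sumD-scale : ∀ u a → sumD (scaleD u a) ≡ u * sumD a
sumD-scale u []            = sym (ℚ.*-zeroʳ u)
sumD-scale u ((p , M) ∷ a) = ≡-trans (cong ((u * p) +_) (sumD-scale u a)) (sym (ℚ.*-distribˡ-+ u p _))

sumD-≈ : ∀ {a b} → a ≈D b → sumD a ≡ sumD b
sumD-≈ []                         = refl
sumD-≈ (prep {p = p} _ a≈)         = cong (p +_) (sumD-≈ a≈)
sumD-≈ (swap {p , _} {q , _} {a})  = solve 3 (λ p q s → p :+ (q :+ s) := q :+ (p :+ s)) refl p q (sumD a)
sumD-≈ (trans a≈ b≈)               = ≡-trans (sumD-≈ a≈) (sumD-≈ b≈)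

sumD-lookupL : ∀ a → sumD a ≡ Σℚ (length a) (λ k → proj₁ (lookupL a k))
sumD-lookupL []            = refl
sumD-lookupL ((p , M) ∷ a) = cong (p +_) (sumD-lookupL a)

WFD-⨆ : ∀ K (p : Fin K → ℚ) (b : Fin K → TDist) → (∀ k → Prob (p k)) → Σℚ K p ≤ 1ℚ →
        (∀ k → WFD (b k)) → WFD (⨆ K (λ k → scaleD (p k) (b k)))
WFD-⨆ K p b p∈ Σp≤1 b-wf = wfD (components K p b p∈ b-wf) (subst (_≤ 1ℚ) (sym (mass K p b)) mass≤1)
  where
  components : ∀ K (p : Fin K → ℚ) (b : Fin K → TDist) → (∀ k → Prob (p k)) → (∀ k → WFD (b k)) →
               WFDs (⨆ K (λ k → scaleD (p k) (b k)))
  components zero    p b p∈ b-wf = []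
  components (suc K) p b p∈ b-wf with b-wf zero
  ... | wfD b₀-wf _ = WFDs-++ (WFDs-scale (p∈ zero) b₀-wf)
                              (components K _ _ (λ k → p∈ (suc k)) (λ k → b-wf (suc k)))

  mass : ∀ K (p : Fin K → ℚ) (b : Fin K → TDist) →
         sumD (⨆ K (λ k → scaleD (p k) (b k))) ≡ Σℚ K (λ k → p k * sumD (b k))
  mass zero    p b = refl
  mass (suc K) p b = ≡-trans (sumD-++ (scaleD (p zero) (b zero)) _)
                             (cong₂ _+_ (sumD-scale (p zero) (b zero)) (mass K (λ k → p (suc k)) (λ k → b (suc k))))

  sumD≤1 : ∀ {a} → WFD a → sumD a ≤ 1ℚ
  sumD≤1 (wfD _ s≤1) = s≤1

  mass≤1 : Σℚ K (λ k → p k * sumD (b k)) ≤ 1ℚ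
  mass≤1 = ℚ.≤-trans (Σℚ-mono-≤ K (λ k → *-≤-of-≤1 (p∈ k) (sumD≤1 (b-wf k)))) Σp≤1

mutual
  WFA-≈ : ∀ {A B} → A ≈A B → WFA A → WFA B
  WFA-≈ (⇒-cong M≈ a≈) (wf⇒ M-wf a-wf) = wf⇒ (WFI-≈ M≈ M-wf) (WFD-≈ a≈ a-wf)

  WFI-≈ : ∀ {M N} → M ≈I N → WFI M → WFI N
  WFI-≈ []            M-wf                       = M-wf
  WFI-≈ (prep A≈ M≈)  ((0<q , q≤1 , A-wf) ∷ M-wf) = (0<q , q≤1 , WFA-≈ A≈ A-wf) ∷ WFI-≈ M≈ M-wf
  WFI-≈ swap          (x ∷ y ∷ M-wf)              = y ∷ x ∷ M-wf
  WFI-≈ (trans M≈ N≈) M-wf                       = WFI-≈ N≈ (WFI-≈ M≈ M-wf)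

  WFDs-≈ : ∀ {a b} → a ≈D b → WFDs a → WFDs b
  WFDs-≈ []            a-wf                       = a-wf
  WFDs-≈ (prep M≈ a≈)  ((0<p , p≤1 , M-wf) ∷ a-wf) = (0<p , p≤1 , WFI-≈ M≈ M-wf) ∷ WFDs-≈ a≈ a-wf
  WFDs-≈ swap          (x ∷ y ∷ a-wf)              = y ∷ x ∷ a-wf
  WFDs-≈ (trans a≈ b≈) a-wf                       = WFDs-≈ b≈ (WFDs-≈ a≈ a-wf)

  WFD-≈ : ∀ {a b} → a ≈D b → WFD a → WFD b
  WFD-≈ a≈ (wfD a-wf s≤1) = wfD (WFDs-≈ a≈ a-wf) (subst (_≤ 1ℚ) (sumD-≈ a≈) s≤1)

WFC-≈ : ∀ {n} {Γ Δ : Ctx n} → Γ ≈C Δ → WFC Γ → WFC Δ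
WFC-≈ []        []          = []
WFC-≈ (M≈ ∷ Γ≈) (M-wf ∷ Γ-wf) = WFI-≈ M≈ M-wf ∷ WFC-≈ Γ≈ Γ-wf

WFC-ε : ∀ {n} → WFC (ε {n})
WFC-ε {zero}  = []
WFC-ε {suc n} = [] ∷ WFC-ε

WFC-⊎ : ∀ {n} {Γ Δ : Ctx n} → WFC Γ → WFC Δ → WFC (Γ ⊎ Δ)
WFC-⊎ []            []            = []
WFC-⊎ (M-wf ∷ Γ-wf) (N-wf ∷ Δ-wf) = WFI-++ M-wf N-wf ∷ WFC-⊎ Γ-wf Δ-wf

WFC-scale : ∀ {n u} {Γ : Ctx n} → Prob u → WFC Γ → WFC (u ·ᶜ Γ)
WFC-scale u∈ []            = []
WFC-scale u∈ (M-wf ∷ Γ-wf) = WFI-scale u∈ M-wf ∷ WFC-scale u∈ Γ-wf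

WFC-∶ᶜ : ∀ {n} (x : Fin n) {M} → WFI M → WFC (x ∶ᶜ M)
WFC-∶ᶜ zero    M-wf = M-wf ∷ WFC-ε
WFC-∶ᶜ (suc x) M-wf = [] ∷ WFC-∶ᶜ x M-wf

WFC-⨄ : ∀ {n} K (f : Fin K → Ctx n) → (∀ k → WFC (f k)) → WFC (⨄ K f)
WFC-⨄ zero    f f-wf = WFC-ε
WFC-⨄ (suc K) f f-wf = WFC-⊎ (f-wf zero) (WFC-⨄ K (λ k → f (suc k)) (λ k → f-wf (suc k)))

WFI-! : ∀ K (q : Fin K → ℚ) (A : Fin K → Arrow) → (∀ k → Prob (q k)) → (∀ k → WFA (A k)) →
        WFI (⨄I K (λ k → (q k , A k) ∷ []))
WFI-! zero    q A q∈ A-wf = []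
WFI-! (suc K) q A q∈ A-wf =
  (proj₁ (q∈ zero) , proj₂ (q∈ zero) , A-wf zero) ∷ WFI-! K _ _ (λ k → q∈ (suc k)) (λ k → A-wf (suc k))

-- Merging and scaling typings of values rebuild (Var) and (!) rules, whose side conditions
-- (well-formed types, scale factors in (0,1]) are recovered from the given derivations.
mutual
  ⊢ᴬ-wf : ∀ {n} {Γ : Ctx n} {w V A} → Γ ⊢ᴬ[ w ] V ∶ A → WFC Γ × WFA A
  ⊢ᴬ-wf (λ-rule ⊢M) with ⊢-wf ⊢M
  ... | M-wf ∷ Γ-wf , b-wf = Γ-wf , wf⇒ M-wf b-wf
  ⊢ᴬ-wf (exA ⊢V Γ≈ A≈) = WFC-≈ Γ≈ (proj₁ (⊢ᴬ-wf ⊢V)) , WFA-≈ A≈ (proj₂ (⊢ᴬ-wf ⊢V))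

  ⊢ᴵ-wf : ∀ {n} {Γ : Ctx n} {w V M} → Γ ⊢ᴵ[ w ] V ∶ M → WFC Γ × WFI M
  ⊢ᴵ-wf (var-rule x M M-wf) = WFC-∶ᶜ x M-wf , M-wf
  ⊢ᴵ-wf (!-rule K q Γ w A q∈ ⊢V) =
    WFC-⨄ K _ (λ k → WFC-scale (q∈ k) (proj₁ (⊢ᴬ-wf (⊢V k)))) ,
    WFI-! K q A q∈ (λ k → proj₂ (⊢ᴬ-wf (⊢V k)))
  ⊢ᴵ-wf (exI ⊢V Γ≈ M≈) = WFC-≈ Γ≈ (proj₁ (⊢ᴵ-wf ⊢V)) , WFI-≈ M≈ (proj₂ (⊢ᴵ-wf ⊢V))

  ⊢-wf : ∀ {n} {Γ : Ctx n} {w M a} → Γ ⊢[ w ] M ∶ a → WFC Γ × WFD a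
  ⊢-wf (zero-rule M) = WFC-ε , wfD [] (ℚ.≤ᵇ⇒≤ _)
  ⊢-wf (app-rule ⊢V ⊢W) with ⊢ᴵ-wf ⊢V | ⊢ᴵ-wf ⊢W
  ... | Γ-wf , ((_ , _ , wf⇒ _ b-wf) ∷ []) | Δ-wf , _ = WFC-⊎ Γ-wf Δ-wf , b-wf
  ⊢-wf (⊕-rule {a = a} {b = b} ⊢M ⊢N) =
    WFC-⊎ (WFC-scale Prob-½ (proj₁ (⊢-wf ⊢M))) (WFC-scale Prob-½ (proj₁ (⊢-wf ⊢N))) ,
    subst WFD (cong (scaleD ½ a ++_) (List.++-identityʳ (scaleD ½ b)))
      (WFD-⨆ 2 (λ _ → ½) ab (λ _ → Prob-½) (ℚ.≤ᵇ⇒≤ _) ab-wf)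
    where
    ab : Fin 2 → TDist
    ab zero       = a
    ab (suc zero) = b
    ab-wf : ∀ k → WFD (ab k)
    ab-wf zero       = proj₂ (⊢-wf ⊢M)
    ab-wf (suc zero) = proj₂ (⊢-wf ⊢N)
  ⊢-wf (let-rule {a = a} ⊢N Δ w b ⊢M) =
    WFC-⊎ (proj₁ (⊢-wf ⊢N)) (WFC-⨄ K _ (λ k → WFC-scale (p∈ k) (Δ-wf k))) ,
    WFD-⨆ K p b p∈ Σp≤1 (λ k → proj₂ (⊢-wf (⊢M k)))
    where
    K : ℕ
    K = length a
    p : Fin K → ℚ
    p k = proj₁ (lookupL a k)
    a-wf : WFD a
    a-wf = proj₂ (⊢-wf ⊢N)
    p∈ : ∀ k → Prob (p k)
    p∈ k = proj₁ (WFD-lookupL a-wf k)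
    Σp≤1 : Σℚ K p ≤ 1ℚ
    Σp≤1 with a-wf
    ... | wfD _ s≤1 = subst (_≤ 1ℚ) (sumD-lookupL a) s≤1
    Δ-wf : ∀ k → WFC (Δ k)
    Δ-wf k with ⊢-wf (⊢M k)
    ... | _ ∷ Δₖ-wf , _ = Δₖ-wf
  ⊢-wf (val-rule ⊢V) = proj₁ (⊢ᴵ-wf ⊢V) , wfD ((proj₁ Prob-1 , proj₂ Prob-1 , proj₂ (⊢ᴵ-wf ⊢V)) ∷ []) (ℚ.≤ᵇ⇒≤ _)
  ⊢-wf (exT ⊢M Γ≈ a≈) = WFC-≈ Γ≈ (proj₁ (⊢-wf ⊢M)) , WFD-≈ a≈ (proj₂ (⊢-wf ⊢M))

⊢ᴵ-conv : ∀ {n} {Γ Γ' : Ctx n} {w w' V M M'} →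
          Γ ≈C Γ' → w ≡ w' → M ≈I M' → Γ ⊢ᴵ[ w ] V ∶ M → Γ' ⊢ᴵ[ w' ] V ∶ M'
⊢ᴵ-conv Γ≈ refl M≈ ⊢V = exI ⊢V Γ≈ M≈

⊢-conv : ∀ {n} {Γ Γ' : Ctx n} {w w' M a a'} →
         Γ ≡ Γ' → w ≡ w' → a ≡ a' → Γ ⊢[ w ] M ∶ a → Γ' ⊢[ w' ] M ∶ a'
⊢-conv refl refl refl ⊢M = ⊢M

⊬ᴬ-var : ∀ {n} {Γ : Ctx n} {w x A} → ¬ (Γ ⊢ᴬ[ w ] var x ∶ A)
⊬ᴬ-var (exA ⊢x _ _) = ⊬ᴬ-var ⊢x

⊢ᴵ-var⁻¹ : ∀ {n} {Γ : Ctx n} {w x M} → Γ ⊢ᴵ[ w ] var x ∶ M → (Γ ≈C (x ∶ᶜ M)) × (w ≡ 0ℚ)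
⊢ᴵ-var⁻¹ (var-rule x M _)                 = ≈C-refl _ , refl
⊢ᴵ-var⁻¹ {x = x} (!-rule zero _ _ _ _ _ _) = ≡⇒≈C (sym (∶ᶜ-[] x)) , refl
⊢ᴵ-var⁻¹ (!-rule (suc K) _ _ _ _ _ ⊢x)     = ⊥-elim (⊬ᴬ-var (⊢x zero))
⊢ᴵ-var⁻¹ {x = x} (exI ⊢x Γ≈ M≈) with ⊢ᴵ-var⁻¹ ⊢x
... | Γ'≈ , w≡0 = ≈C-trans (≈C-sym Γ≈) (≈C-trans Γ'≈ (∶ᶜ-cong x M≈)) , w≡0

record ScaledArrowTyping {n} (V : Val n) : Set where
  constructor scaledArrowTyping
  field
    factor      : ℚ
    factor-prob : Prob factor
    context     : Ctx n
    weight      : ℚ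
    arrow       : Arrow
    derivation  : context ⊢ᴬ[ weight ] V ∶ arrow
open ScaledArrowTyping

module _ {n} {V : Val n} where
  contextOf : List (ScaledArrowTyping V) → Ctx n
  contextOf []      = ε
  contextOf (t ∷ L) = (factor t ·ᶜ context t) ⊎ contextOf L

  weightOf : List (ScaledArrowTyping V) → ℚ
  weightOf []      = 0ℚ
  weightOf (t ∷ L) = factor t * weight t + weightOf L

  typeOf : List (ScaledArrowTyping V) → Inter
  typeOf []      = []
  typeOf (t ∷ L) = (factor t , arrow t) ∷ typeOf L

  ⊢ᴵ-! : (L : List (ScaledArrowTyping V)) → contextOf L ⊢ᴵ[ weightOf L ] V ∶ typeOf L
  ⊢ᴵ-! L = ⊢ᴵ-conv (≡⇒≈C (context≡ L)) (weight≡ L) (≡⇒≈I (type≡ L))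
             (!-rule (length L) (factor ∘ at) (context ∘ at) (weight ∘ at) (arrow ∘ at)
                     (factor-prob ∘ at) (derivation ∘ at))
    where
    at : Fin (length L) → ScaledArrowTyping V
    at = lookupL L

    context≡ : ∀ L → ⨄ (length L) (λ i → factor (lookupL L i) ·ᶜ context (lookupL L i)) ≡ contextOf L
    context≡ []      = refl
    context≡ (t ∷ L) = cong ((factor t ·ᶜ context t) ⊎_) (context≡ L)

    weight≡ : ∀ L → Σℚ (length L) (λ i → factor (lookupL L i) * weight (lookupL L i)) ≡ weightOf L
    weight≡ []      = refl
    weight≡ (t ∷ L) = cong ((factor t * weight t) +_) (weight≡ L)

    type≡ : ∀ L → ⨄I (length L) (λ i → (factor (lookupL L i) , arrow (lookupL L i)) ∷ []) ≡ typeOf L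
    type≡ []      = refl
    type≡ (t ∷ L) = cong ((factor t , arrow t) ∷_) (type≡ L)

  contextOf-++ : ∀ L₁ L₂ → contextOf (L₁ ++ L₂) ≡ (contextOf L₁ ⊎ contextOf L₂)
  contextOf-++ []       L₂ = sym (⊎-identityˡ _)
  contextOf-++ (t ∷ L₁) L₂ =
    ≡-trans (cong ((factor t ·ᶜ context t) ⊎_) (contextOf-++ L₁ L₂)) (sym (⊎-assoc _ _ _))

  weightOf-++ : ∀ L₁ L₂ → weightOf (L₁ ++ L₂) ≡ weightOf L₁ + weightOf L₂
  weightOf-++ []       L₂ = sym (ℚ.+-identityˡ _)
  weightOf-++ (t ∷ L₁) L₂ =
    ≡-trans (cong ((factor t * weight t) +_) (weightOf-++ L₁ L₂)) (sym (ℚ.+-assoc (factor t * weight t) (weightOf L₁) (weightOf L₂)))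

  typeOf-++ : ∀ L₁ L₂ → typeOf (L₁ ++ L₂) ≡ (typeOf L₁ ++ typeOf L₂)
  typeOf-++ []       L₂ = refl
  typeOf-++ (t ∷ L₁) L₂ = cong (_ ∷_) (typeOf-++ L₁ L₂)

  rescale : ∀ u → Prob u → ScaledArrowTyping V → ScaledArrowTyping V
  rescale u u∈ t = record t { factor = u * factor t ; factor-prob = Prob-* u∈ (factor-prob t) }

  contextOf-rescale : ∀ u u∈ L → contextOf (map (rescale u u∈) L) ≡ (u ·ᶜ contextOf L)
  contextOf-rescale u u∈ []      = sym (·ᶜ-ε u)
  contextOf-rescale u u∈ (t ∷ L) =
    ≡-trans (cong₂ _⊎_ (sym (·ᶜ-* u (factor t) (context t))) (contextOf-rescale u u∈ L)) (sym (·ᶜ-distrib-⊎ u _ _))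

  weightOf-rescale : ∀ u u∈ L → weightOf (map (rescale u u∈) L) ≡ u * weightOf L
  weightOf-rescale u u∈ []      = sym (ℚ.*-zeroʳ u)
  weightOf-rescale u u∈ (t ∷ L) =
    ≡-trans (cong ((u * factor t) * weight t +_) (weightOf-rescale u u∈ L))
            (solve 4 (λ u q w r → (u :* q) :* w :+ u :* r := u :* (q :* w :+ r)) refl u (factor t) (weight t) (weightOf L))

  typeOf-rescale : ∀ u u∈ L → typeOf (map (rescale u u∈) L) ≡ scaleI u (typeOf L)
  typeOf-rescale u u∈ []      = refl
  typeOf-rescale u u∈ (t ∷ L) = cong (_ ∷_) (typeOf-rescale u u∈ L)

⊢ᴵ-lam⁻¹ : ∀ {n} {Γ : Ctx n} {w M} (B : Term (suc n)) → Γ ⊢ᴵ[ w ] lam B ∶ M →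
           Σ (List (ScaledArrowTyping (lam B))) λ L → (Γ ≈C contextOf L) × (w ≡ weightOf L) × (M ≈I typeOf L)
⊢ᴵ-lam⁻¹ B (!-rule K q Γ w A q∈ ⊢λ) =
  premises K q Γ w A q∈ ⊢λ , ≡⇒≈C (sym (context≡ K)) , sym (weight≡ K) , ≡⇒≈I (sym (type≡ K))
  where
  premises : ∀ K (q : Fin K → ℚ) (Γ : Fin K → Ctx _) (w : Fin K → ℚ) (A : Fin K → Arrow) →
             (∀ i → Prob (q i)) → (∀ i → Γ i ⊢ᴬ[ w i ] lam B ∶ A i) → List (ScaledArrowTyping (lam B))
  premises zero    q Γ w A q∈ ⊢λ = []
  premises (suc K) q Γ w A q∈ ⊢λ =
    scaledArrowTyping (q zero) (q∈ zero) (Γ zero) (w zero) (A zero) (⊢λ zero) ∷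
    premises K (q ∘ suc) (Γ ∘ suc) (w ∘ suc) (A ∘ suc) (q∈ ∘ suc) (⊢λ ∘ suc)

  context≡ : ∀ K {q Γ w A q∈ ⊢λ} → contextOf (premises K q Γ w A q∈ ⊢λ) ≡ ⨄ K (λ i → q i ·ᶜ Γ i)
  context≡ zero            = refl
  context≡ (suc K) {q} {Γ} = cong ((q zero ·ᶜ Γ zero) ⊎_) (context≡ K)

  weight≡ : ∀ K {q Γ w A q∈ ⊢λ} → weightOf (premises K q Γ w A q∈ ⊢λ) ≡ Σℚ K (λ i → q i * w i)
  weight≡ zero              = refl
  weight≡ (suc K) {q} {_} {w} = cong ((q zero * w zero) +_) (weight≡ K)

  type≡ : ∀ K {q Γ w A q∈ ⊢λ} → typeOf (premises K q Γ w A q∈ ⊢λ) ≡ ⨄I K (λ i → (q i , A i) ∷ [])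
  type≡ zero                  = refl
  type≡ (suc K) {q} {_} {_} {A} = cong ((q zero , A zero) ∷_) (type≡ K)
⊢ᴵ-lam⁻¹ B (exI ⊢λ Γ≈ M≈) with ⊢ᴵ-lam⁻¹ B ⊢λ
... | L , Γ'≈ , w≡ , M'≈ = L , ≈C-trans (≈C-sym Γ≈) Γ'≈ , w≡ , trans (≈I-sym M≈) M'≈

⊢ᴵ-[] : ∀ {n} (V : Val n) → ε ⊢ᴵ[ 0ℚ ] V ∶ []
⊢ᴵ-[] V = !-rule 0 (λ ()) (λ ()) (λ ()) (λ ()) (λ ()) (λ ())

⊢ᴵ-++ : ∀ {n} (V : Val n) {Γ₁ Γ₂ : Ctx n} {w₁ w₂ M₁ M₂} →
        Γ₁ ⊢ᴵ[ w₁ ] V ∶ M₁ → Γ₂ ⊢ᴵ[ w₂ ] V ∶ M₂ → (Γ₁ ⊎ Γ₂) ⊢ᴵ[ w₁ + w₂ ] V ∶ (M₁ ++ M₂)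
⊢ᴵ-++ (var x) {M₁ = M₁} {M₂} ⊢x₁ ⊢x₂ with ⊢ᴵ-var⁻¹ ⊢x₁ | ⊢ᴵ-var⁻¹ ⊢x₂
... | Γ₁≈ , w₁≡0 | Γ₂≈ , w₂≡0 =
  ⊢ᴵ-conv (≈C-sym (≈C-trans (⊎-cong Γ₁≈ Γ₂≈) (≡⇒≈C (∶ᶜ-⊎ x M₁ M₂))))
          (sym (≡-trans (cong₂ _+_ w₁≡0 w₂≡0) (ℚ.+-identityˡ 0ℚ)))
          (≈I-refl _)
          (var-rule x (M₁ ++ M₂) (WFI-++ (proj₂ (⊢ᴵ-wf ⊢x₁)) (proj₂ (⊢ᴵ-wf ⊢x₂))))
⊢ᴵ-++ (lam B) ⊢λ₁ ⊢λ₂ with ⊢ᴵ-lam⁻¹ B ⊢λ₁ | ⊢ᴵ-lam⁻¹ B ⊢λ₂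
... | L₁ , Γ₁≈ , w₁≡ , M₁≈ | L₂ , Γ₂≈ , w₂≡ , M₂≈ =
  ⊢ᴵ-conv (≈C-sym (≈C-trans (⊎-cong Γ₁≈ Γ₂≈) (≡⇒≈C (sym (contextOf-++ L₁ L₂)))))
          (sym (≡-trans (cong₂ _+_ w₁≡ w₂≡) (sym (weightOf-++ L₁ L₂))))
          (≈I-sym (trans (++-cong-≈I M₁≈ M₂≈) (≡⇒≈I (sym (typeOf-++ L₁ L₂)))))
          (⊢ᴵ-! (L₁ ++ L₂))

⊢ᴵ-scale : ∀ {n} (V : Val n) {Γ : Ctx n} {w M} u → Prob u → Γ ⊢ᴵ[ w ] V ∶ M →
           (u ·ᶜ Γ) ⊢ᴵ[ u * w ] V ∶ scaleI u M
⊢ᴵ-scale (var x) {M = M} u u∈ ⊢x with ⊢ᴵ-var⁻¹ ⊢x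
... | Γ≈ , w≡0 =
  ⊢ᴵ-conv (≈C-sym (≈C-trans (·ᶜ-cong u Γ≈) (≡⇒≈C (·ᶜ-∶ᶜ u x M))))
          (sym (≡-trans (cong (u *_) w≡0) (ℚ.*-zeroʳ u)))
          (≈I-refl _)
          (var-rule x (scaleI u M) (WFI-scale u∈ (proj₂ (⊢ᴵ-wf ⊢x))))
⊢ᴵ-scale (lam B) u u∈ ⊢λ with ⊢ᴵ-lam⁻¹ B ⊢λ
... | L , Γ≈ , w≡ , M≈ =
  ⊢ᴵ-conv (≈C-sym (≈C-trans (·ᶜ-cong u Γ≈) (≡⇒≈C (sym (contextOf-rescale u u∈ L)))))
          (sym (≡-trans (cong (u *_) w≡) (sym (weightOf-rescale u u∈ L))))
          (≈I-sym (trans (scaleI-cong u M≈) (≡⇒≈I (sym (typeOf-rescale u u∈ L)))))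
          (⊢ᴵ-! (map (rescale u u∈) L))

-- Inverting renaming

renCtx : ∀ {n m} → (Fin n → Fin m) → Ctx n → Ctx m
renCtx ρ []      = ε
renCtx ρ (M ∷ Θ) = (ρ zero ∶ᶜ M) ⊎ renCtx (ρ ∘ suc) Θ

renCtx-ε : ∀ {n m} (ρ : Fin n → Fin m) → renCtx ρ ε ≡ ε
renCtx-ε {zero}  ρ = refl
renCtx-ε {suc n} ρ = ≡-trans (cong₂ _⊎_ (∶ᶜ-[] (ρ zero)) (renCtx-ε (ρ ∘ suc))) (⊎-identityˡ ε)

renCtx-⊎ : ∀ {n m} (ρ : Fin n → Fin m) (Θ₁ Θ₂ : Ctx n) → renCtx ρ (Θ₁ ⊎ Θ₂) ≈C (renCtx ρ Θ₁ ⊎ renCtx ρ Θ₂)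
renCtx-⊎ ρ []       []       = ≡⇒≈C (sym (⊎-identityˡ ε))
renCtx-⊎ ρ (M ∷ Θ₁) (N ∷ Θ₂) =
  ≈C-trans (⊎-cong (≡⇒≈C (sym (∶ᶜ-⊎ (ρ zero) M N))) (renCtx-⊎ (ρ ∘ suc) Θ₁ Θ₂)) (⊎-interchange _ _ _ _)

renCtx-·ᶜ : ∀ {n m} (ρ : Fin n → Fin m) u (Θ : Ctx n) → renCtx ρ (u ·ᶜ Θ) ≡ (u ·ᶜ renCtx ρ Θ)
renCtx-·ᶜ ρ u []      = sym (·ᶜ-ε u)
renCtx-·ᶜ ρ u (M ∷ Θ) =
  ≡-trans (cong₂ _⊎_ (sym (·ᶜ-∶ᶜ u (ρ zero) M)) (renCtx-·ᶜ (ρ ∘ suc) u Θ)) (sym (·ᶜ-distrib-⊎ u _ _))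

renCtx-∶ᶜ : ∀ {n m} (ρ : Fin n → Fin m) (x : Fin n) M → renCtx ρ (x ∶ᶜ M) ≈C (ρ x ∶ᶜ M)
renCtx-∶ᶜ ρ zero    M = ≡⇒≈C (≡-trans (cong ((ρ zero ∶ᶜ M) ⊎_) (renCtx-ε (ρ ∘ suc))) (⊎-identityʳ _))
renCtx-∶ᶜ ρ (suc x) M =
  ≈C-trans (≡⇒≈C (≡-trans (cong (_⊎ renCtx (ρ ∘ suc) (x ∶ᶜ M)) (∶ᶜ-[] (ρ zero))) (⊎-identityˡ _)))
           (renCtx-∶ᶜ (ρ ∘ suc) x M)

renCtx-suc : ∀ {n m} (ρ : Fin n → Fin m) Θ → renCtx (suc ∘ ρ) Θ ≡ ([] ∷ renCtx ρ Θ)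
renCtx-suc ρ []      = refl
renCtx-suc ρ (M ∷ Θ) = cong (([] ∷ (ρ zero ∶ᶜ M)) ⊎_) (renCtx-suc (ρ ∘ suc) Θ)

renCtx-extR : ∀ {n m} (ρ : Fin n → Fin m) M Θ → renCtx (extR ρ) (M ∷ Θ) ≡ (M ∷ renCtx ρ Θ)
renCtx-extR ρ M Θ =
  ≡-trans (cong ((M ∷ ε) ⊎_) (renCtx-suc ρ Θ)) (cong₂ _∷_ (List.++-identityʳ M) (⊎-identityˡ _))

renCtx-id : ∀ {n} (Θ : Ctx n) → renCtx (λ i → i) Θ ≡ Θ
renCtx-id []      = refl
renCtx-id (M ∷ Θ) = ≡-trans (renCtx-extR (λ i → i) M Θ) (cong (M ∷_) (renCtx-id Θ))

renCtx-⊎⁺ : ∀ {n m} (ρ : Fin n → Fin m) Θ₁ Θ₂ {Γ₁ Γ₂} →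
            Γ₁ ≈C renCtx ρ Θ₁ → Γ₂ ≈C renCtx ρ Θ₂ → (Γ₁ ⊎ Γ₂) ≈C renCtx ρ (Θ₁ ⊎ Θ₂)
renCtx-⊎⁺ ρ Θ₁ Θ₂ Γ₁≈ Γ₂≈ = ≈C-trans (⊎-cong Γ₁≈ Γ₂≈) (≈C-sym (renCtx-⊎ ρ Θ₁ Θ₂))

renCtx-·ᶜ⁺ : ∀ {n m} (ρ : Fin n → Fin m) u Θ {Γ} → Γ ≈C renCtx ρ Θ → (u ·ᶜ Γ) ≈C renCtx ρ (u ·ᶜ Θ)
renCtx-·ᶜ⁺ ρ u Θ Γ≈ = ≈C-trans (·ᶜ-cong u Γ≈) (≡⇒≈C (sym (renCtx-·ᶜ ρ u Θ)))

renCtx-⨄⁺ : ∀ {n m} (ρ : Fin n → Fin m) K (p : Fin K → ℚ) (Θ : Fin K → Ctx n) {Γ : Fin K → Ctx m} →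
            (∀ k → Γ k ≈C renCtx ρ (Θ k)) → ⨄ K (λ k → p k ·ᶜ Γ k) ≈C renCtx ρ (⨄ K (λ k → p k ·ᶜ Θ k))
renCtx-⨄⁺ ρ zero    p Θ Γ≈ = ≡⇒≈C (sym (renCtx-ε ρ))
renCtx-⨄⁺ ρ (suc K) p Θ Γ≈ =
  renCtx-⊎⁺ ρ (p zero ·ᶜ Θ zero) _ (renCtx-·ᶜ⁺ ρ (p zero) (Θ zero) (Γ≈ zero)) (renCtx-⨄⁺ ρ K (p ∘ suc) (Θ ∘ suc) (Γ≈ ∘ suc))

RenPreimage : ∀ {n m} → (Fin n → Fin m) → (Ctx n → Set) → Ctx m → Set
RenPreimage {n} ρ J Γ = Σ (Ctx n) λ Θ → J Θ × (Γ ≈C renCtx ρ Θ)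

RenPreimage-resp : ∀ {n m} {ρ : Fin n → Fin m} {J J' : Ctx n → Set} {Γ Γ'} →
                   (∀ {Θ} → J Θ → J' Θ) → Γ' ≈C Γ → RenPreimage ρ J Γ → RenPreimage ρ J' Γ'
RenPreimage-resp J⇒J' Γ'≈ (Θ , j , Γ≈) = Θ , J⇒J' j , ≈C-trans Γ'≈ Γ≈

RenPreimage-unbind : ∀ {n m} (ρ : Fin n → Fin m) {B : Term (suc n)} {M Δ w b} →
  RenPreimage (extR ρ) (λ Θ → Θ ⊢[ w ] B ∶ b) (M ∷ Δ) → RenPreimage ρ (λ Θ → (M ∷ Θ) ⊢[ w ] B ∶ b) Δ
RenPreimage-unbind ρ (N ∷ Θ , ⊢B , Γ≈) with ≈C-trans Γ≈ (≡⇒≈C (renCtx-extR ρ N Θ))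
... | M≈N ∷ Δ≈ = Θ , exT ⊢B (≈I-sym M≈N ∷ ≈C-refl Θ) (≈D-refl _) , Δ≈

mutual
  ⊢-renT⁻¹ : ∀ {n m} (ρ : Fin n → Fin m) (M : Term n) {Γ : Ctx m} {w a} →
             Γ ⊢[ w ] renT ρ M ∶ a → RenPreimage ρ (λ Θ → Θ ⊢[ w ] M ∶ a) Γ
  ⊢-renT⁻¹ ρ (val V) (val-rule ⊢V) = RenPreimage-resp val-rule (≈C-refl _) (⊢ᴵ-renV⁻¹ ρ V ⊢V)
  ⊢-renT⁻¹ ρ (app V W) (app-rule ⊢V ⊢W) with ⊢ᴵ-renV⁻¹ ρ V ⊢V | ⊢ᴵ-renV⁻¹ ρ W ⊢W
  ... | Θ₁ , ⊢V' , Γ₁≈ | Θ₂ , ⊢W' , Γ₂≈ = Θ₁ ⊎ Θ₂ , app-rule ⊢V' ⊢W' , renCtx-⊎⁺ ρ Θ₁ Θ₂ Γ₁≈ Γ₂≈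
  ⊢-renT⁻¹ ρ (M ⊕ N) (⊕-rule ⊢M ⊢N) with ⊢-renT⁻¹ ρ M ⊢M | ⊢-renT⁻¹ ρ N ⊢N
  ... | Θ₁ , ⊢M' , Γ₁≈ | Θ₂ , ⊢N' , Γ₂≈ =
    (½ ·ᶜ Θ₁) ⊎ (½ ·ᶜ Θ₂) , ⊕-rule ⊢M' ⊢N' , renCtx-⊎⁺ ρ (½ ·ᶜ Θ₁) (½ ·ᶜ Θ₂) (renCtx-·ᶜ⁺ ρ ½ Θ₁ Γ₁≈) (renCtx-·ᶜ⁺ ρ ½ Θ₂ Γ₂≈)
  ⊢-renT⁻¹ ρ (lett N B) (let-rule {a = a} ⊢N Δ w b ⊢B) with ⊢-renT⁻¹ ρ N ⊢N
  ... | Θ , ⊢N' , Γ≈ =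
    Θ ⊎ ⨄ K (λ k → p k ·ᶜ Δ' k) ,
    let-rule ⊢N' Δ' w b (λ k → proj₁ (proj₂ (body k))) ,
    renCtx-⊎⁺ ρ Θ _ Γ≈ (renCtx-⨄⁺ ρ K p Δ' (λ k → proj₂ (proj₂ (body k))))
    where
    K : ℕ
    K = length a
    p : Fin K → ℚ
    p k = proj₁ (lookupL a k)
    body : ∀ k → RenPreimage ρ (λ Θ → (proj₂ (lookupL a k) ∷ Θ) ⊢[ w k ] B ∶ b k) (Δ k)
    body k = RenPreimage-unbind ρ (⊢-renT⁻¹ (extR ρ) B (⊢B k))
    Δ' : Fin K → Ctx _
    Δ' k = proj₁ (body k)
  ⊢-renT⁻¹ ρ M (zero-rule _) = ε , zero-rule M , ≡⇒≈C (sym (renCtx-ε ρ))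
  ⊢-renT⁻¹ ρ M (exT ⊢M Γ≈ a≈) =
    RenPreimage-resp (λ ⊢M' → exT ⊢M' (≈C-refl _) a≈) (≈C-sym Γ≈) (⊢-renT⁻¹ ρ M ⊢M)

  ⊢ᴵ-renV⁻¹ : ∀ {n m} (ρ : Fin n → Fin m) (V : Val n) {Γ : Ctx m} {w M} →
              Γ ⊢ᴵ[ w ] renV ρ V ∶ M → RenPreimage ρ (λ Θ → Θ ⊢ᴵ[ w ] V ∶ M) Γ
  ⊢ᴵ-renV⁻¹ ρ (var x) (var-rule _ M M-wf) = x ∶ᶜ M , var-rule x M M-wf , ≈C-sym (renCtx-∶ᶜ ρ x M)
  ⊢ᴵ-renV⁻¹ ρ V (!-rule K q Γ w A q∈ ⊢V) =
    ⨄ K (λ k → q k ·ᶜ Γ' k) ,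
    !-rule K q Γ' w A q∈ (λ k → proj₁ (proj₂ (premise k))) ,
    renCtx-⨄⁺ ρ K q Γ' (λ k → proj₂ (proj₂ (premise k)))
    where
    premise : ∀ k → RenPreimage ρ (λ Θ → Θ ⊢ᴬ[ w k ] V ∶ A k) (Γ k)
    premise k = ⊢ᴬ-renV⁻¹ ρ V (⊢V k)
    Γ' : Fin K → Ctx _
    Γ' k = proj₁ (premise k)
  ⊢ᴵ-renV⁻¹ ρ V (exI ⊢V Γ≈ M≈) =
    RenPreimage-resp (λ ⊢V' → exI ⊢V' (≈C-refl _) M≈) (≈C-sym Γ≈) (⊢ᴵ-renV⁻¹ ρ V ⊢V)

  ⊢ᴬ-renV⁻¹ : ∀ {n m} (ρ : Fin n → Fin m) (V : Val n) {Γ : Ctx m} {w A} →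
              Γ ⊢ᴬ[ w ] renV ρ V ∶ A → RenPreimage ρ (λ Θ → Θ ⊢ᴬ[ w ] V ∶ A) Γ
  ⊢ᴬ-renV⁻¹ ρ (lam B) (λ-rule ⊢B) =
    RenPreimage-resp λ-rule (≈C-refl _) (RenPreimage-unbind ρ (⊢-renT⁻¹ (extR ρ) B ⊢B))
  ⊢ᴬ-renV⁻¹ ρ V (exA ⊢V Γ≈ A≈) =
    RenPreimage-resp (λ ⊢V' → exA ⊢V' (≈C-refl _) A≈) (≈C-sym Γ≈) (⊢ᴬ-renV⁻¹ ρ V ⊢V)

-- Inverting substitution

record SubstTyping {n m} (σ : Fin n → Val m) (Θ : Ctx n) (Γ : Ctx m) (v : ℚ) : Set where
  constructor substTyping
  field
    ctxs    : Fin n → Ctx m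
    weights : Fin n → ℚ
    ⊢σ      : ∀ i → ctxs i ⊢ᴵ[ weights i ] σ i ∶ lookup Θ i
    ctx≈    : Γ ≈C ⨄ n ctxs
    weight≡ : v ≡ Σℚ n weights

SubstTyping-resp : ∀ {n m} {σ : Fin n → Val m} {Θ Γ Γ' v} → Γ' ≈C Γ → SubstTyping σ Θ Γ v → SubstTyping σ Θ Γ' v
SubstTyping-resp Γ'≈ (substTyping Γs vs ⊢σ Γ≈ v≡) = substTyping Γs vs ⊢σ (≈C-trans Γ'≈ Γ≈) v≡

SubstTyping-∷ : ∀ {n m} {σ : Fin (suc n) → Val m} {Θ Γ v Γ₀ v₀ M} →
                Γ₀ ⊢ᴵ[ v₀ ] σ zero ∶ M → SubstTyping (σ ∘ suc) Θ Γ v → SubstTyping σ (M ∷ Θ) (Γ₀ ⊎ Γ) (v₀ + v)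
SubstTyping-∷ {n} {m} {σ} {Θ} {Γ₀ = Γ₀} {v₀} {M} ⊢σ₀ (substTyping Γs vs ⊢σ Γ≈ v≡) =
  substTyping Γs' vs' ⊢σ' (⊎-cong (≈C-refl Γ₀) Γ≈) (cong (v₀ +_) v≡)
  where
  Γs' : Fin (suc n) → Ctx m
  Γs' zero    = Γ₀
  Γs' (suc i) = Γs i
  vs' : Fin (suc n) → ℚ
  vs' zero    = v₀
  vs' (suc i) = vs i
  ⊢σ' : ∀ i → Γs' i ⊢ᴵ[ vs' i ] σ i ∶ lookup (M ∷ Θ) i
  ⊢σ' zero    = ⊢σ₀
  ⊢σ' (suc i) = ⊢σ i

SubstTyping-ε : ∀ {n m} (σ : Fin n → Val m) → SubstTyping σ ε ε 0ℚ
SubstTyping-ε {zero}  σ = substTyping (λ ()) (λ ()) (λ ()) (≈C-refl ε) refl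
SubstTyping-ε {suc n} σ =
  subst (SubstTyping σ ε ε) (ℚ.+-identityˡ 0ℚ)
    (SubstTyping-resp (≡⇒≈C (sym (⊎-identityˡ ε))) (SubstTyping-∷ (⊢ᴵ-[] (σ zero)) (SubstTyping-ε (σ ∘ suc))))

SubstTyping-∶ᶜ : ∀ {n m} (σ : Fin n → Val m) (x : Fin n) {Γ v M} →
                 Γ ⊢ᴵ[ v ] σ x ∶ M → SubstTyping σ (x ∶ᶜ M) Γ v
SubstTyping-∶ᶜ σ zero    {v = v} ⊢σx =
  subst (SubstTyping σ _ _) (ℚ.+-identityʳ v)
    (SubstTyping-resp (≡⇒≈C (sym (⊎-identityʳ _))) (SubstTyping-∷ ⊢σx (SubstTyping-ε (σ ∘ suc))))
SubstTyping-∶ᶜ σ (suc x) {v = v} ⊢σx =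
  subst (SubstTyping σ _ _) (ℚ.+-identityˡ v)
    (SubstTyping-resp (≡⇒≈C (sym (⊎-identityˡ _))) (SubstTyping-∷ (⊢ᴵ-[] (σ zero)) (SubstTyping-∶ᶜ (σ ∘ suc) x ⊢σx)))

SubstTyping-⊎ : ∀ {n m} {σ : Fin n → Val m} {Θ₁ Θ₂ Γ₁ Γ₂ v₁ v₂} →
                SubstTyping σ Θ₁ Γ₁ v₁ → SubstTyping σ Θ₂ Γ₂ v₂ → SubstTyping σ (Θ₁ ⊎ Θ₂) (Γ₁ ⊎ Γ₂) (v₁ + v₂)
SubstTyping-⊎ {n} {σ = σ} {Θ₁} {Θ₂} (substTyping Γs₁ vs₁ ⊢σ₁ Γ₁≈ v₁≡) (substTyping Γs₂ vs₂ ⊢σ₂ Γ₂≈ v₂≡) =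
  substTyping (λ i → Γs₁ i ⊎ Γs₂ i) (λ i → vs₁ i + vs₂ i)
    (λ i → subst (_ ⊢ᴵ[ _ ] σ i ∶_) (sym (Vec.lookup-zipWith _++_ i Θ₁ Θ₂)) (⊢ᴵ-++ (σ i) (⊢σ₁ i) (⊢σ₂ i)))
    (≈C-trans (⊎-cong Γ₁≈ Γ₂≈) (≈C-sym (⨄-⊎ n Γs₁ Γs₂)))
    (≡-trans (cong₂ _+_ v₁≡ v₂≡) (sym (Σℚ-+ n vs₁ vs₂)))

SubstTyping-·ᶜ : ∀ {n m} {σ : Fin n → Val m} {Θ Γ v} u → Prob u →
                 SubstTyping σ Θ Γ v → SubstTyping σ (u ·ᶜ Θ) (u ·ᶜ Γ) (u * v)
SubstTyping-·ᶜ {n} {σ = σ} {Θ} u u∈ (substTyping Γs vs ⊢σ Γ≈ v≡) =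
  substTyping (λ i → u ·ᶜ Γs i) (λ i → u * vs i)
    (λ i → subst (_ ⊢ᴵ[ _ ] σ i ∶_) (sym (Vec.lookup-map i (scaleI u) Θ)) (⊢ᴵ-scale (σ i) u u∈ (⊢σ i)))
    (≈C-trans (·ᶜ-cong u Γ≈) (≡⇒≈C (·ᶜ-⨄ u n Γs)))
    (≡-trans (cong (u *_) v≡) (Σℚ-*ˡ u n vs))

SubstTyping-⨄ : ∀ {n m} {σ : Fin n → Val m} K (p : Fin K → ℚ) → (∀ k → Prob (p k)) →
                {Θ : Fin K → Ctx n} {Γ : Fin K → Ctx m} {v : Fin K → ℚ} →
                (∀ k → SubstTyping σ (Θ k) (Γ k) (v k)) →
                SubstTyping σ (⨄ K (λ k → p k ·ᶜ Θ k)) (⨄ K (λ k → p k ·ᶜ Γ k)) (Σℚ K (λ k → p k * v k))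
SubstTyping-⨄ {σ = σ} zero    p p∈ ⊢σ = SubstTyping-ε σ
SubstTyping-⨄         (suc K) p p∈ ⊢σ =
  SubstTyping-⊎ (SubstTyping-·ᶜ (p zero) (p∈ zero) (⊢σ zero)) (SubstTyping-⨄ K (p ∘ suc) (p∈ ∘ suc) (⊢σ ∘ suc))

-- extS σ sends the bound variable to itself, typed at weight 0 in context zero ∶ M; every other
-- σ i is renamed by suc, so its typing comes from one that does not mention the bound variable.
SubstTyping-extS⁻¹ : ∀ {n m} {σ : Fin n → Val m} {M Θ Γ v} → SubstTyping (extS σ) (M ∷ Θ) Γ v →
                     Σ (Ctx m) λ Δ → (Γ ≈C (M ∷ Δ)) × SubstTyping σ Θ Δ v
SubstTyping-extS⁻¹ {n} {m} {σ} {M} {Θ} {Γ} {v} (substTyping Γs vs ⊢σ Γ≈ v≡) =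
  ⨄ n Δs , Γ≈M∷⨄Δs , substTyping Δs (vs ∘ suc) (λ i → proj₁ (proj₂ (unrenamed i))) (≈C-refl _) v≡Σ
  where
  bound : (Γs zero ≈C (zero ∶ᶜ M)) × (vs zero ≡ 0ℚ)
  bound = ⊢ᴵ-var⁻¹ (⊢σ zero)

  unrenamed : ∀ i → RenPreimage suc (λ Δ → Δ ⊢ᴵ[ vs (suc i) ] σ i ∶ lookup Θ i) (Γs (suc i))
  unrenamed i = ⊢ᴵ-renV⁻¹ suc (σ i) (⊢σ (suc i))

  Δs : Fin n → Ctx m
  Δs i = proj₁ (unrenamed i)

  Γs≈ : ∀ i → Γs (suc i) ≈C ([] ∷ Δs i)
  Γs≈ i = ≈C-trans (proj₂ (proj₂ (unrenamed i)))
                   (≡⇒≈C (≡-trans (renCtx-suc (λ j → j) (Δs i)) (cong ([] ∷_) (renCtx-id (Δs i)))))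

  Γ≈M∷⨄Δs : Γ ≈C (M ∷ ⨄ n Δs)
  Γ≈M∷⨄Δs =
    ≈C-trans Γ≈ (≈C-trans (⊎-cong (proj₁ bound) (⨄-cong n Γs≈))
                          (≡⇒≈C (≡-trans (cong ((M ∷ ε) ⊎_) (⨄-[]∷ n Δs))
                                         (cong₂ _∷_ (List.++-identityʳ M) (⊎-identityˡ _)))))

  v≡Σ : v ≡ Σℚ n (vs ∘ suc)
  v≡Σ = ≡-trans v≡ (≡-trans (cong (_+ Σℚ n (vs ∘ suc)) (proj₂ bound)) (ℚ.+-identityˡ _))

-- J is a judgement about M, while Γ and w belong to the judgement about subT σ M.
record SubstSplit {n m} (σ : Fin n → Val m) (J : Ctx n → ℚ → Set) (Γ : Ctx m) (w : ℚ) : Set where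
  constructor substSplit
  field
    ctx         : Ctx n
    ownWeight   : ℚ
    substWeight : ℚ
    judgement   : J ctx ownWeight
    ⊢subst      : SubstTyping σ ctx Γ substWeight
    weight≡+    : w ≡ ownWeight + substWeight
open SubstSplit

SubstSplit-map : ∀ {n m} {σ : Fin n → Val m} {J J' : Ctx n → ℚ → Set} {Γ Γ' w} →
                 (∀ {Θ w₀} → J Θ w₀ → J' Θ w₀) → Γ' ≈C Γ → SubstSplit σ J Γ w → SubstSplit σ J' Γ' w
SubstSplit-map J⇒J' Γ'≈ (substSplit Θ w₀ v j ⊢σ w≡) = substSplit Θ w₀ v (J⇒J' j) (SubstTyping-resp Γ'≈ ⊢σ) w≡

SubstSplit-unbind : ∀ {n m} {σ : Fin n → Val m} {B : Term (suc n)} {b M Δ w} →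
                    SubstSplit (extS σ) (λ Θ w₀ → Θ ⊢[ w₀ ] B ∶ b) (M ∷ Δ) w →
                    SubstSplit σ (λ Θ w₀ → (M ∷ Θ) ⊢[ w₀ ] B ∶ b) Δ w
SubstSplit-unbind (substSplit (N ∷ Θ) w₀ v ⊢B ⊢σ w≡) with SubstTyping-extS⁻¹ ⊢σ
... | Δ' , M≈N ∷ Δ≈ , ⊢σ' =
  substSplit Θ w₀ v (exT ⊢B (≈I-sym M≈N ∷ ≈C-refl Θ) (≈D-refl _)) (SubstTyping-resp Δ≈ ⊢σ') w≡

mutual
  ⊢-subT⁻¹ : ∀ {n m} (σ : Fin n → Val m) (M : Term n) {Γ : Ctx m} {w a} →
             Γ ⊢[ w ] subT σ M ∶ a → SubstSplit σ (λ Θ w₀ → Θ ⊢[ w₀ ] M ∶ a) Γ w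
  ⊢-subT⁻¹ σ (val V) (val-rule ⊢V) = SubstSplit-map val-rule (≈C-refl _) (⊢ᴵ-subV⁻¹ σ V ⊢V)
  ⊢-subT⁻¹ σ (app V W) (app-rule ⊢V ⊢W) with ⊢ᴵ-subV⁻¹ σ V ⊢V | ⊢ᴵ-subV⁻¹ σ W ⊢W
  ... | substSplit Θ₁ w₁ v₁ ⊢V' ⊢σ₁ w≡₁ | substSplit Θ₂ w₂ v₂ ⊢W' ⊢σ₂ w≡₂ =
    substSplit (Θ₁ ⊎ Θ₂) (w₁ + w₂) (v₁ + v₂) (app-rule ⊢V' ⊢W') (SubstTyping-⊎ ⊢σ₁ ⊢σ₂)
      (≡-trans (cong₂ _+_ w≡₁ w≡₂)
               (solve 4 (λ a b c d → (a :+ b) :+ (c :+ d) := (a :+ c) :+ (b :+ d)) refl w₁ v₁ w₂ v₂))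
  ⊢-subT⁻¹ σ (M ⊕ N) (⊕-rule ⊢M ⊢N) with ⊢-subT⁻¹ σ M ⊢M | ⊢-subT⁻¹ σ N ⊢N
  ... | substSplit Θ₁ w₁ v₁ ⊢M' ⊢σ₁ w≡₁ | substSplit Θ₂ w₂ v₂ ⊢N' ⊢σ₂ w≡₂ =
    substSplit ((½ ·ᶜ Θ₁) ⊎ (½ ·ᶜ Θ₂)) (½ * w₁ + ½ * w₂ + 1ℚ) (½ * v₁ + ½ * v₂) (⊕-rule ⊢M' ⊢N')
      (SubstTyping-⊎ (SubstTyping-·ᶜ ½ Prob-½ ⊢σ₁) (SubstTyping-·ᶜ ½ Prob-½ ⊢σ₂))
      (≡-trans (cong₂ (λ x y → ½ * x + ½ * y + 1ℚ) w≡₁ w≡₂)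
               (solve 5 (λ h a b c d → h :* (a :+ b) :+ h :* (c :+ d) :+ con 1ℚ
                                       := (h :* a :+ h :* c :+ con 1ℚ) :+ (h :* b :+ h :* d))
                      refl ½ w₁ v₁ w₂ v₂))
  ⊢-subT⁻¹ σ (lett N B) (let-rule {a = a} ⊢N Δ w b ⊢B) with ⊢-subT⁻¹ σ N ⊢N
  ... | substSplit Θ w₀ v ⊢N' ⊢σ w≡ =
    substSplit (Θ ⊎ ⨄ K (λ k → p k ·ᶜ ctx (body k))) (Σp*own + w₀ + 1ℚ) (v + Σp*subst)
      (let-rule ⊢N' (ctx ∘ body) (ownWeight ∘ body) b (judgement ∘ body))
      (SubstTyping-⊎ ⊢σ (SubstTyping-⨄ K p p∈ (⊢subst ∘ body)))
      (≡-trans (cong₂ (λ x y → x + y + 1ℚ) (Σℚ-*-split K p w _ _ (weight≡+ ∘ body)) w≡)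
               (solve 5 (λ A B c d o → (A :+ B) :+ (c :+ d) :+ o := (A :+ c :+ o) :+ (d :+ B))
                      refl Σp*own Σp*subst w₀ v 1ℚ))
    where
    K : ℕ
    K = length a
    p : Fin K → ℚ
    p k = proj₁ (lookupL a k)
    p∈ : ∀ k → Prob (p k)
    p∈ k = proj₁ (WFD-lookupL (proj₂ (⊢-wf ⊢N)) k)
    body : ∀ k → SubstSplit σ (λ Θ w₀ → (proj₂ (lookupL a k) ∷ Θ) ⊢[ w₀ ] B ∶ b k) (Δ k) (w k)
    body k = SubstSplit-unbind (⊢-subT⁻¹ (extS σ) B (⊢B k))
    Σp*own Σp*subst : ℚ
    Σp*own   = Σℚ K (λ k → p k * ownWeight (body k))
    Σp*subst = Σℚ K (λ k → p k * substWeight (body k))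
  ⊢-subT⁻¹ σ M (zero-rule _) = substSplit ε 0ℚ 0ℚ (zero-rule M) (SubstTyping-ε σ) (sym (ℚ.+-identityʳ 0ℚ))
  ⊢-subT⁻¹ σ M (exT ⊢M Γ≈ a≈) =
    SubstSplit-map (λ ⊢M' → exT ⊢M' (≈C-refl _) a≈) (≈C-sym Γ≈) (⊢-subT⁻¹ σ M ⊢M)

  ⊢ᴵ-subV⁻¹ : ∀ {n m} (σ : Fin n → Val m) (V : Val n) {Γ : Ctx m} {w M} →
              Γ ⊢ᴵ[ w ] subV σ V ∶ M → SubstSplit σ (λ Θ w₀ → Θ ⊢ᴵ[ w₀ ] V ∶ M) Γ w
  ⊢ᴵ-subV⁻¹ σ (var x) {w = w} {M} ⊢σx =
    substSplit (x ∶ᶜ M) 0ℚ w (var-rule x M (proj₂ (⊢ᴵ-wf ⊢σx))) (SubstTyping-∶ᶜ σ x ⊢σx) (sym (ℚ.+-identityˡ w))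
  ⊢ᴵ-subV⁻¹ σ (lam B) (!-rule K q Γ w A q∈ ⊢λ) =
    substSplit (⨄ K (λ k → q k ·ᶜ ctx (premise k))) (Σℚ K (λ k → q k * ownWeight (premise k)))
               (Σℚ K (λ k → q k * substWeight (premise k)))
      (!-rule K q (ctx ∘ premise) (ownWeight ∘ premise) A q∈ (judgement ∘ premise))
      (SubstTyping-⨄ K q q∈ (⊢subst ∘ premise))
      (Σℚ-*-split K q w _ _ (weight≡+ ∘ premise))
    where
    premise : ∀ k → SubstSplit σ (λ Θ w₀ → Θ ⊢ᴬ[ w₀ ] lam B ∶ A k) (Γ k) (w k)
    premise k = ⊢ᴬ-subV-lam⁻¹ σ B (⊢λ k)
  ⊢ᴵ-subV⁻¹ σ (lam B) (exI ⊢λ Γ≈ M≈) =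
    SubstSplit-map (λ ⊢λ' → exI ⊢λ' (≈C-refl _) M≈) (≈C-sym Γ≈) (⊢ᴵ-subV⁻¹ σ (lam B) ⊢λ)

  ⊢ᴬ-subV-lam⁻¹ : ∀ {n m} (σ : Fin n → Val m) (B : Term (suc n)) {Γ : Ctx m} {w A} →
                  Γ ⊢ᴬ[ w ] lam (subT (extS σ) B) ∶ A → SubstSplit σ (λ Θ w₀ → Θ ⊢ᴬ[ w₀ ] lam B ∶ A) Γ w
  ⊢ᴬ-subV-lam⁻¹ σ B (λ-rule ⊢B) with SubstSplit-unbind (⊢-subT⁻¹ (extS σ) B ⊢B)
  ... | substSplit Θ w₀ v ⊢B' ⊢σ w≡ =
    substSplit Θ (w₀ + 1ℚ) v (λ-rule ⊢B') ⊢σ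
      (≡-trans (cong (_+ 1ℚ) w≡) (solve 3 (λ a b c → (a :+ b) :+ c := (a :+ c) :+ b) refl w₀ v 1ℚ))
  ⊢ᴬ-subV-lam⁻¹ σ B (exA ⊢λ Γ≈ A≈) =
    SubstSplit-map (λ ⊢λ' → exA ⊢λ' (≈C-refl _) A≈) (≈C-sym Γ≈) (⊢ᴬ-subV-lam⁻¹ σ B ⊢λ)

-- Subject expansion

⊢-[/0]⁻¹ : ∀ {V : Val 0} {M : Term 1} {w a} → ε ⊢[ w ] (M [ V /0]) ∶ a →
           Σ Inter λ 𝓜 → Σ ℚ λ w₁ → Σ ℚ λ v →
             ((𝓜 ∷ ε) ⊢[ w₁ ] M ∶ a) × (ε ⊢ᴵ[ v ] V ∶ 𝓜) × (w ≡ w₁ + v)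
⊢-[/0]⁻¹ {V} {M} ⊢M[V] with ⊢-subT⁻¹ (σ₀ V) M ⊢M[V]
... | substSplit (𝓜 ∷ []) w₁ v ⊢M (substTyping Γs vs ⊢σ _ v≡) w≡ =
  𝓜 , w₁ , vs zero , ⊢M ,
  subst (_⊢ᴵ[ vs zero ] V ∶ 𝓜) (ctx₀≡ε (Γs zero)) (⊢σ zero) ,
  ≡-trans w≡ (cong (w₁ +_) (≡-trans v≡ (ℚ.+-identityʳ (vs zero))))

data Componentwise {A : Set} (T : A → ℚ → TDist → Set) : List (ℚ × A) → Set where
  []  : Componentwise T []
  _∷_ : ∀ {p x xs} → Σ ℚ (λ w → Σ TDist (T x w)) → Componentwise T xs → Componentwise T ((p , x) ∷ xs)

module _ {A : Set} {T : A → ℚ → TDist → Set} where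
  mixType : ∀ {xs} → Componentwise T xs → TDist
  mixType []                            = []
  mixType (_∷_ {p} (w , a , _) R) = scaleD p a ++ mixType R

  mixWeight : ∀ {xs} → Componentwise T xs → ℚ
  mixWeight []                            = 0ℚ
  mixWeight (_∷_ {p} (w , a , _) R) = p * w + mixWeight R

  Componentwise-tabulate : ∀ xs (w : Fin (length xs) → ℚ) (a : Fin (length xs) → TDist) →
    (∀ i → T (proj₂ (lookupL xs i)) (w i) (a i)) →
    Σ (Componentwise T xs) λ R → (mixType R ≡ ⨆ (length xs) (λ i → scaleD (proj₁ (lookupL xs i)) (a i)))
                               × (mixWeight R ≡ Σℚ (length xs) (λ i → proj₁ (lookupL xs i) * w i))
  Componentwise-tabulate []             w a t = [] , refl , refl
  Componentwise-tabulate ((p , x) ∷ xs) w a t with Componentwise-tabulate xs (w ∘ suc) (a ∘ suc) (t ∘ suc)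
  ... | R , type≡ , weight≡ =
    (w zero , a zero , t zero) ∷ R , cong (scaleD p (a zero) ++_) type≡ , cong (p * w zero +_) weight≡

  weightAt : ∀ {xs} → Componentwise T xs → Fin (length xs) → ℚ
  weightAt ((w , _) ∷ R) zero    = w
  weightAt (_ ∷ R)       (suc i) = weightAt R i

  typeAt : ∀ {xs} → Componentwise T xs → Fin (length xs) → TDist
  typeAt ((_ , a , _) ∷ R) zero    = a
  typeAt (_ ∷ R)           (suc i) = typeAt R i

  typingAt : ∀ {xs} (R : Componentwise T xs) i → T (proj₂ (lookupL xs i)) (weightAt R i) (typeAt R i)
  typingAt ((_ , _ , t) ∷ R) zero    = t
  typingAt (_ ∷ R)           (suc i) = typingAt R i

  mixWeight-lookup : ∀ {xs} (R : Componentwise T xs) →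
                     Σℚ (length xs) (λ i → proj₁ (lookupL xs i) * weightAt R i) ≡ mixWeight R
  mixWeight-lookup []                      = refl
  mixWeight-lookup (_∷_ {p} (w , _) R) = cong (p * w +_) (mixWeight-lookup R)

  mixType-lookup : ∀ {xs} (R : Componentwise T xs) →
                   ⨆ (length xs) (λ i → scaleD (proj₁ (lookupL xs i)) (typeAt R i)) ≡ mixType R
  mixType-lookup []                          = refl
  mixType-lookup (_∷_ {p} (_ , a , _) R) = cong (scaleD p a ++_) (mixType-lookup R)

  _++ᶜ_ : ∀ {xs ys} → Componentwise T xs → Componentwise T ys → Componentwise T (xs ++ ys)
  []      ++ᶜ S = S
  (t ∷ R) ++ᶜ S = t ∷ (R ++ᶜ S)

  mixType-++ : ∀ {xs ys} (R : Componentwise T xs) (S : Componentwise T ys) →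
               mixType (R ++ᶜ S) ≡ mixType R ++ mixType S
  mixType-++ []                          S = refl
  mixType-++ (_∷_ {p} (_ , a , _) R) S =
    ≡-trans (cong (scaleD p a ++_) (mixType-++ R S)) (sym (List.++-assoc (scaleD p a) _ _))

  mixWeight-++ : ∀ {xs ys} (R : Componentwise T xs) (S : Componentwise T ys) →
                 mixWeight (R ++ᶜ S) ≡ mixWeight R + mixWeight S
  mixWeight-++ []                      S = sym (ℚ.+-identityˡ _)
  mixWeight-++ (_∷_ {p} (w , _) R) S =
    ≡-trans (cong (p * w +_) (mixWeight-++ R S)) (sym (ℚ.+-assoc (p * w) _ _))

module _ {T : Inter → ℚ → TDist → Set} where
  scaleᶜ : ∀ q {c} → Componentwise T c → Componentwise T (scaleD q c)
  scaleᶜ q []      = []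
  scaleᶜ q (t ∷ R) = t ∷ scaleᶜ q R

  mixType-scale : ∀ q {c} (R : Componentwise T c) → mixType (scaleᶜ q R) ≡ scaleD q (mixType R)
  mixType-scale q []                          = refl
  mixType-scale q (_∷_ {p} (_ , a , _) R) =
    ≡-trans (cong₂ _++_ (sym (scaleD-* q p a)) (mixType-scale q R)) (sym (List.map-++ _ (scaleD p a) (mixType R)))

  mixWeight-scale : ∀ q {c} (R : Componentwise T c) → mixWeight (scaleᶜ q R) ≡ q * mixWeight R
  mixWeight-scale q []                      = sym (ℚ.*-zeroʳ q)
  mixWeight-scale q (_∷_ {p} (w , _) R) =
    ≡-trans (cong ((q * p) * w +_) (mixWeight-scale q R))
            (solve 4 (λ q p w s → (q :* p) :* w :+ q :* s := q :* (p :* w :+ s)) refl q p w (mixWeight R))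

ClosedTypings : MDist 0 → Set
ClosedTypings = Componentwise (λ P w a → ε ⊢[ w ] P ∶ a)

BodyTypings : Term 1 → TDist → Set
BodyTypings B = Componentwise (λ 𝓜 w b → (𝓜 ∷ ε) ⊢[ w ] B ∶ b)

⊢-let : ∀ {N : Term 0} {B v c} → ε ⊢[ v ] N ∶ c → (R : BodyTypings B c) →
        ε ⊢[ mixWeight R + v + 1ℚ ] lett N B ∶ mixType R
⊢-let ⊢N R = ⊢-conv (ctx₀≡ε _) (cong (λ x → x + _ + 1ℚ) (mixWeight-lookup R)) (mixType-lookup R)
               (let-rule ⊢N (λ _ → ε) (weightAt R) (typeAt R) (typingAt R))

-- The (Zero) rule can type a let by 𝟎 at weight 0, hence only an inequality on weights.
⊢-let⁻¹ : ∀ {N : Term 0} {B} {Γ : Ctx 0} {w a} → Γ ⊢[ w ] lett N B ∶ a →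
          Σ TDist λ c → Σ ℚ λ v → (ε ⊢[ v ] N ∶ c) ×
            Σ (BodyTypings B c) λ R → (mixType R ≈D a) × (w ≤ mixWeight R + v + 1ℚ)
⊢-let⁻¹ {N} (zero-rule _) = [] , 0ℚ , zero-rule N , [] , [] , ℚ.≤ᵇ⇒≤ _
⊢-let⁻¹ (exT ⊢let _ a≈) with ⊢-let⁻¹ ⊢let
... | c , v , ⊢N , R , mix≈ , w≤ = c , v , ⊢N , R , trans mix≈ a≈ , w≤
⊢-let⁻¹ {B = B} (let-rule {Γ = Γ} {v = v} {a = c} ⊢N Δ w b ⊢B)
  with Componentwise-tabulate c w b (λ k → ⊢-conv (cong (_ ∷_) (ctx₀≡ε (Δ k))) refl refl (⊢B k))
... | R , type≡ , weight≡ =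
  c , v , ⊢-conv (ctx₀≡ε Γ) refl refl ⊢N , R , ≡⇒≈D type≡ ,
  ℚ.≤-reflexive (cong (λ x → x + v + 1ℚ) (sym weight≡))

mass : ∀ {n} → MDist n → ℚ
mass []            = 0ℚ
mass ((p , _) ∷ D) = p + mass D

NonNegativeProbs : ∀ {n} → MDist n → Set
NonNegativeProbs = All (λ pM → 0ℚ ≤ proj₁ pM)

letBody : ∀ {n} → Term (suc n) → ℚ × Term n → ℚ × Term n
letBody B (p , N) = (p , lett N B)

⟶-distribution : ∀ {n} {P : Term n} {D} → P ⟶ D → (mass D ≡ 1ℚ) × NonNegativeProbs D
⟶-distribution (β M V)      = ℚ.+-identityʳ 1ℚ , ℚ.≤ᵇ⇒≤ _ ∷ []
⟶-distribution (letV V M)   = ℚ.+-identityʳ 1ℚ , ℚ.≤ᵇ⇒≤ _ ∷ []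
⟶-distribution (choice M N) = refl , ℚ.≤ᵇ⇒≤ _ ∷ ℚ.≤ᵇ⇒≤ _ ∷ []
⟶-distribution (letC {D = D} B N⟶D) with ⟶-distribution N⟶D
... | mass≡1 , nonNeg = ≡-trans (mass-map D) mass≡1 , nonNeg-map nonNeg
  where
  mass-map : ∀ D → mass (map (letBody B) D) ≡ mass D
  mass-map []            = refl
  mass-map ((p , N) ∷ D) = cong (p +_) (mass-map D)

  nonNeg-map : ∀ {D} → NonNegativeProbs D → NonNegativeProbs (map (letBody B) D)
  nonNeg-map []             = []
  nonNeg-map (0≤p ∷ nonNeg) = 0≤p ∷ nonNeg-map nonNeg

-- mass D collects the 1 that each let of the reduct pays for its (let) rule.
ClosedTypings-letBody⁻¹ : ∀ {B : Term 1} (D : MDist 0) → NonNegativeProbs D →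
  (T : ClosedTypings (map (letBody B) D)) →
  Σ (ClosedTypings D) λ T' → Σ (BodyTypings B (mixType T')) λ R →
    (mixType R ≈D mixType T) × (mixWeight T ≤ mixWeight R + mixWeight T' + mass D)
ClosedTypings-letBody⁻¹ []            []             []                   = [] , [] , [] , ℚ.≤ᵇ⇒≤ _
ClosedTypings-letBody⁻¹ {B} ((q , N) ∷ D) (0≤q ∷ nonNeg) ((w , a , ⊢let) ∷ T)
  with ⊢-let⁻¹ ⊢let | ClosedTypings-letBody⁻¹ D nonNeg T
... | c , v , ⊢N , R₁ , mix₁≈ , w≤ | T' , R , mix≈ , rest≤ =
  (v , c , ⊢N) ∷ T' , scaleᶜ q R₁ ++ᶜ R , type≈ , weight≤
  where
  open ℚ.≤-Reasoning
  R' : BodyTypings B (scaleD q c ++ mixType T')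
  R' = scaleᶜ q R₁ ++ᶜ R

  mixType-R' : mixType R' ≡ scaleD q (mixType R₁) ++ mixType R
  mixType-R' = ≡-trans (mixType-++ (scaleᶜ q R₁) R) (cong (_++ mixType R) (mixType-scale q R₁))

  mixWeight-R' : mixWeight R' ≡ q * mixWeight R₁ + mixWeight R
  mixWeight-R' = ≡-trans (mixWeight-++ (scaleᶜ q R₁) R) (cong (_+ mixWeight R) (mixWeight-scale q R₁))

  type≈ : mixType R' ≈D (scaleD q a ++ mixType T)
  type≈ = subst (_≈D (scaleD q a ++ mixType T)) (sym mixType-R') (++-cong-≈D (scaleD-cong q mix₁≈) mix≈)

  weight≤ : q * w + mixWeight T ≤ mixWeight R' + (q * v + mixWeight T') + (q + mass D)
  weight≤ = begin
    q * w + mixWeight T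
      ≤⟨ ℚ.+-mono-≤ (ℚ.*-monoˡ-≤-nonNeg q {{ℚ.nonNegative 0≤q}} w≤) rest≤ ⟩
    q * (mixWeight R₁ + v + 1ℚ) + (mixWeight R + mixWeight T' + mass D)
      ≡⟨ solve 6 (λ q r₁ v r t m → q :* (r₁ :+ v :+ con 1ℚ) :+ (r :+ t :+ m)
                                   := (q :* r₁ :+ r) :+ (q :* v :+ t) :+ (q :* con 1ℚ :+ m))
                 refl q (mixWeight R₁) v (mixWeight R) (mixWeight T') (mass D) ⟩
    (q * mixWeight R₁ + mixWeight R) + (q * v + mixWeight T') + (q * 1ℚ + mass D)
      ≡⟨ cong₂ (λ x y → x + (q * v + mixWeight T') + (y + mass D)) (sym mixWeight-R') (ℚ.*-identityʳ q) ⟩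
    mixWeight R' + (q * v + mixWeight T') + (q + mass D) ∎

subject-expansion : ∀ {P : Term 0} {D} → P ⟶ D → (T : ClosedTypings D) →
                    Σ ℚ λ w → (ε ⊢[ w ] P ∶ mixType T) × (1ℚ + mixWeight T ≤ w)
subject-expansion (β M V) ((w , a , ⊢M[V]) ∷ []) with ⊢-[/0]⁻¹ {V} {M} ⊢M[V]
... | 𝓜 , w₁ , v , ⊢M , ⊢V , w≡ =
  _ ,
  ⊢-conv refl refl (sym (≡-trans (List.++-identityʳ _) (scaleD-identity a)))
    (app-rule (!-rule 1 (λ _ → 1ℚ) (λ _ → ε) (λ _ → w₁ + 1ℚ) (λ _ → 𝓜 ⇒ a) (λ _ → Prob-1) (λ _ → λ-rule ⊢M)) ⊢V) ,
  ℚ.≤-reflexive (≡-trans (cong (λ x → 1ℚ + (1ℚ * x + 0ℚ)) w≡)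
    (solve 2 (λ a b → con 1ℚ :+ (con 1ℚ :* (a :+ b) :+ con 0ℚ)
                      := (con 1ℚ :* (a :+ con 1ℚ) :+ con 0ℚ) :+ b) refl w₁ v))
subject-expansion (letV V M) ((w , a , ⊢M[V]) ∷ []) with ⊢-[/0]⁻¹ {V} {M} ⊢M[V]
... | 𝓜 , w₁ , v , ⊢M , ⊢V , w≡ =
  _ ,
  let-rule (val-rule ⊢V) (λ _ → ε) (λ _ → w₁) (λ _ → a) (λ { zero → ⊢M }) ,
  ℚ.≤-reflexive (≡-trans (cong (λ x → 1ℚ + (1ℚ * x + 0ℚ)) w≡)
    (solve 2 (λ a b → con 1ℚ :+ (con 1ℚ :* (a :+ b) :+ con 0ℚ)
                      := (con 1ℚ :* a :+ con 0ℚ) :+ b :+ con 1ℚ) refl w₁ v))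
subject-expansion (choice M N) ((w₀ , a₀ , ⊢M) ∷ (w₁ , a₁ , ⊢N) ∷ []) =
  _ ,
  ⊢-conv refl refl (cong (scaleD ½ a₀ ++_) (sym (List.++-identityʳ _))) (⊕-rule ⊢M ⊢N) ,
  ℚ.≤-reflexive (solve 3 (λ h a b → con 1ℚ :+ (h :* a :+ (h :* b :+ con 0ℚ)) := h :* a :+ h :* b :+ con 1ℚ)
                         refl ½ w₀ w₁)
subject-expansion (letC {D = D} B N⟶D) T with ⟶-distribution N⟶D
... | mass≡1 , nonNeg with ClosedTypings-letBody⁻¹ D nonNeg T
... | T' , R , mix≈ , weight≤ with subject-expansion N⟶D T'
... | w' , ⊢N , 1+w'≤ =
  mixWeight R + w' + 1ℚ , exT (⊢-let ⊢N R) [] mix≈ ,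
  (begin
    1ℚ + mixWeight T
      ≤⟨ ℚ.+-monoʳ-≤ 1ℚ weight≤ ⟩
    1ℚ + (mixWeight R + mixWeight T' + mass D)
      ≡⟨ solve 4 (λ r t m o → o :+ (r :+ t :+ m) := r :+ (o :+ t) :+ m) refl (mixWeight R) (mixWeight T') (mass D) 1ℚ ⟩
    mixWeight R + (1ℚ + mixWeight T') + mass D
      ≤⟨ ℚ.+-mono-≤ (ℚ.+-monoʳ-≤ (mixWeight R) 1+w'≤) (ℚ.≤-reflexive mass≡1) ⟩
    mixWeight R + w' + 1ℚ ∎)
  where open ℚ.≤-Reasoning

mainTheorem9 : (P : Term 0) (D : MDist 0) → P ⟶ D →
    (w : Fin (length D) → ℚ) (a : Fin (length D) → TDist) →
    (∀ i → ε ⊢[ w i ] proj₂ (lookupL D i) ∶ a i) →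
    Σ ℚ λ w' → Σ TDist λ a' →
      (ε ⊢[ w' ] P ∶ a')
      × (a' ≡ ⨆ (length D) (λ i → scaleD (proj₁ (lookupL D i)) (a i)))
      × (1ℚ + Σℚ (length D) (λ i → proj₁ (lookupL D i) * w i) ≤ w')
mainTheorem9 P D P⟶D w a ⊢Pᵢ with Componentwise-tabulate D w a ⊢Pᵢ
... | T , type≡ , weight≡ with subject-expansion P⟶D T
... | w' , ⊢P , weight≤ = w' , mixType T , ⊢P , type≡ , subst (λ x → 1ℚ + x ≤ w') weight≡ weight≤
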